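{- Let $\mathbb{F}_q$ be a finite field of characteristic $p$ and $\psi(x)=e^{2\pi i\,{\rm Tr}_{\mathbb{F}_q/\mathbb{F}_p}(x)/p}$ its canonical additive character. Let $\chi,\eta$ be non-trivial characters of $\mathbb{F}_q^\times$ and $\chi_0$ the trivial character. For $y\in\mathbb{F}_q^\times$ put $$B(y)=\sum_{t\in\mathbb{F}_q\setminus\{0,1\}}\chi(t)\,\eta\big(1-y(1-t)^{ -1}\big).$$ Then for every $y\in\mathbb{F}_q^\times$, $$B(y)=\frac{ -\tau(\chi)\tau(\eta)}{\sqrt q}\,H\big(y,q;(\chi_0,\chi_0),(\chi,\eta)\big).$$
   Context: Characters of $\mathbb{F}_q^\times$ are extended by zero at $0$. $\tau(\chi)=\sum_{a\in\mathbb{F}_q}\chi(a)\psi(a)$ is the Gauss sum. For $t\in\mathbb{F}_q^\times$, Katz's hypergeometric sum is $$H\big(t,q;(\chi_0,\chi_0),(\chi,\eta)\big)=\frac{(-1)^{3}}{q^{3/2}}\sum_{\substack{x_1,x_2,y_1,y_2\in\mathbb{F}_q^\times\\ x_1x_2=t\,y_1y_2}}\overline{\chi}(y_1)\,\overline{\eta}(y_2)\,\psi(x_1+x_2-y_1-y_2).$$ -}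

module Defs where

open import Level using (Level; 0ℓ)
open import Data.Nat as ℕ using (ℕ; zero; suc)
open import Data.Nat.Primality using (Prime)
open import Data.List using (List; []; _∷_; filter; length; foldr; map)
open import Data.List.Membership.Propositional using (_∈_)
open import Data.List.Relation.Unary.Unique.Propositional using (Unique)
open import Data.Product using (Σ; _×_; _,_)
open import Relation.Binary.PropositionalEquality using (_≡_; _≢_)
open import Relation.Binary.Definitions using (DecidableEquality)
open import Relation.Nullary using (yes; no; ¬_)
open import Relation.Nullary.Decidable using (¬?)
open import Algebra.Structures using (IsCommutativeRing)
open import Algebra.Bundles using (CommutativeRing)

natMul : {a : Level} {A : Set a} → A → (A → A → A) → ℕ → A → A
natMul z _ zero    a = z
natMul z _⊕_ (suc n) a = a ⊕ natMul z _⊕_ n a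

natPow : {a : Level} {A : Set a} → A → (A → A → A) → A → ℕ → A
natPow o _ a zero    = o
natPow o _⊗_ a (suc n) = a ⊗ natPow o _⊗_ a n

record FiniteField : Set₁ where
  infixl 6 _+_
  infixl 7 _*_
  field
    F          : Set
    _+_ _*_    : F → F → F
    -_         : F → F
    0# 1#      : F
    isCommRing : IsCommutativeRing _≡_ _+_ _*_ -_ 0# 1#
    _≟_        : DecidableEquality F
    0≢1        : 0# ≢ 1#
    inv        : F → F
    inv-0      : inv 0# ≡ 0#
    inv-r      : ∀ x → x ≢ 0# → x * inv x ≡ 1#
    elems      : List F
    complete   : ∀ x → x ∈ elems
    unique     : Unique elems
    p n        : ℕ
    p-prime    : Prime p
    char-p     : natMul 0# _+_ p 1# ≡ 0#
    card       : length elems ≡ p ℕ.^ n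

  q : ℕ
  q = length elems

  _-_ : F → F → F
  a - b = a + (- b)

  _^_ : F → ℕ → F
  _^_ = natPow 1# _*_

  units : List F
  units = filter (λ x → ¬? (x ≟ 0#)) elems

  Tr : F → F
  Tr x = go n
    where
    go : ℕ → F
    go zero    = 0#
    go (suc i) = (x ^ (p ℕ.^ i)) + go i

  -- the integer k ∈ {0,...,p-1} with Tr(x) = k·1 (searching k < p)
  trℕ : F → ℕ
  trℕ x = search p
    where
    search : ℕ → ℕ
    search zero    = 0
    search (suc m) with Tr x ≟ natMul 0# _+_ (p ℕ.∸ suc m) 1#
    ... | yes _ = p ℕ.∸ suc m
    ... | no  _ = search m

-- The character sums, with values in a commutative ring K
-- (playing the role of ℂ).

module CharSums {c ℓ : Level} (𝔽 : FiniteField) (K : CommutativeRing c ℓ) where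
  open FiniteField 𝔽 renaming (_+_ to _+F_; _*_ to _*F_; -_ to -F_; 0# to 0F; 1# to 1F; _-_ to _-F_)
  open CommutativeRing K renaming (Carrier to 𝕂)

  Σ[_]_ : {A : Set} → List A → (A → 𝕂) → 𝕂
  Σ[ xs ] f = foldr (λ a s → f a + s) 0# xs

  powK : 𝕂 → ℕ → 𝕂
  powK = natPow 1# _*_

  ℕ→K : ℕ → 𝕂
  ℕ→K m = natMul 0# _+_ m 1#

  record MulChar : Set (c Level.⊔ ℓ) where
    field
      χ      : F → 𝕂
      χ-0    : χ 0F ≈ 0#
      χ-1    : χ 1F ≈ 1#
      χ-mul  : ∀ a b → a ≢ 0F → b ≢ 0F → χ (a *F b) ≈ χ a * χ b

  open MulChar public

  Nontrivial : MulChar → Set ℓ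
  Nontrivial ch = Σ F λ a → a ≢ 0F × ¬ (χ ch a ≈ 1#)

  -- complex conjugate of a character: conj(χ(a)) = χ(a)^{-1} = χ(a^{-1})
  conjχ : MulChar → F → 𝕂
  conjχ ch a = χ ch (inv a)

  -- canonical additive character ψ(x) = ζ^{Tr(x)}, ζ a primitive p-th root of 1
  ψ : 𝕂 → F → 𝕂
  ψ ζ x = powK ζ (trℕ x)

  τ : 𝕂 → MulChar → 𝕂
  τ ζ ch = Σ[ elems ] λ a → χ ch a * ψ ζ a

  [_≡F_] : F → F → 𝕂
  [ a ≡F b ] with a ≟ b
  ... | yes _ = 1#
  ... | no  _ = 0#

  Hsum : 𝕂 → MulChar → MulChar → F → 𝕂
  Hsum ζ ch eh t =
    Σ[ units ] λ x₁ → Σ[ units ] λ x₂ → Σ[ units ] λ y₁ → Σ[ units ] λ y₂ →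
      [ x₁ *F x₂ ≡F t *F (y₁ *F y₂) ] *
      (conjχ ch y₁ * (conjχ eh y₂ * ψ ζ (((x₁ +F x₂) -F y₁) -F y₂)))

  -- Katz's H(t,q;(χ0,χ0),(χ,η)) = (-1)^3 q^{-3/2} Hsum, where sqrtq⁻¹ = 1/√q
  H : 𝕂 → 𝕂 → MulChar → MulChar → F → 𝕂
  H ζ sqrtq⁻¹ ch eh t =
    powK (- 1#) 3 * (powK sqrtq⁻¹ 3 * Hsum ζ ch eh t)

  B : MulChar → MulChar → F → 𝕂
  B ch eh y =
    Σ[ filter (λ t → ¬? (t ≟ 1F)) units ] λ t →
      χ ch t * χ eh (1F -F (y *F inv (1F -F t)))

{-# OPTIONS --safe #-}
module Submission where

-- Everything reduces to Gauss sums. For χ ≠ 1 and τ̄(χ) = τ(χ̄) one has the twisted identity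
-- ∑_u χ̄(u) ψ(c u) = χ(c) τ̄(χ) and the norm τ(χ) τ̄(χ) = χ(-1) q. In the four-fold sum of H,
-- solving x₁ x₂ = y y₁ y₂ for x₂ turns the y₂-sum into a twisted Gauss sum of η; substituting
-- x₁ = y₁ w turns the y₁-sum into one of χ; and w = 1 - t leaves B(y). Thus
-- τ(χ) τ(η) ∑ = q² B(y), and dividing by q² = s⁴ gives the claim.
-- That ψ = ζ ^ trℕ is a nontrivial additive character needs Tr to be additive (Frobenius), to take
-- values in 𝔽_p (the roots of X ^ p - X) and not to vanish identically (a polynomial of degree
-- p ^ (n - 1) < q).

open import Defs
open import Level using (Level; 0ℓ)
open import Data.Bool using (true; false; if_then_else_)
open import Data.Empty using (⊥-elim)
open import Data.Fin.Base using (Fin; toℕ; inject₁; fromℕ) renaming (zero to fzero; suc to fsuc)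
open import Data.Fin.Properties using (toℕ-inject₁; toℕ-fromℕ; toℕ<n)
open import Data.Integer.Base as ℤ using (ℤ; -[1+_]; _◃_; sign; ∣_∣; _⊖_)
import Data.Integer.Properties as ℤ
open import Data.List using (List; []; _∷_; _++_; map; filter; length; foldr; applyUpTo)
open import Data.List.Properties using (filter-all; length-applyUpTo)
open import Data.List.Membership.Propositional using (_∈_)
open import Data.List.Membership.Propositional.Properties
  using (∈-∃++; ∈-map⁺; ∈-map⁻; ∈-filter⁺; ∈-filter⁻; ∈-applyUpTo⁻)
open import Data.List.Relation.Unary.Any as Any using (here; there; any?)
open import Data.List.Relation.Unary.All as All using (All; []; _∷_)
open import Data.List.Relation.Unary.All.Properties using (all-filter; ¬Any⇒All¬)
open import Data.List.Relation.Unary.AllPairs using ([]; _∷_)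
open import Data.List.Relation.Unary.Unique.Propositional using (Unique)
open import Data.List.Relation.Unary.Unique.Propositional.Properties using (map⁺; filter⁺; applyUpTo⁺₁)
open import Data.Maybe using (Maybe; just; nothing)
open import Data.Nat as ℕ using (ℕ; zero; suc)
import Data.Nat.Properties as ℕ
open import Data.Nat.Combinatorics using (_C_; nCk+nC[k+1]≡[n+1]C[k+1]; nC1≡n; nCn≡1)
open import Data.Nat.Coprimality using (prime⇒coprime; coprime-Bézout)
open import Data.Nat.Divisibility using (_∣_; divides; ∣⇒≤)
open import Data.Nat.DivMod using (_%_; _/_; m≡m%n+[m/n]*n; m%n<n)
open import Data.Nat.GCD using (module Bézout)
open import Data.Nat.Primality using (Prime; euclidsLemma; prime⇒nonZero; prime⇒nonTrivial)
open import Data.Product using (Σ; _×_; _,_; proj₁; proj₂)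
open import Data.Sign.Base as Sign using (Sign)
open import Data.Sum using (_⊎_; inj₁; inj₂)
open import Relation.Nullary using (¬_; Dec; does; yes; no)
open import Relation.Nullary.Decidable using (¬?; decidable-stable)
open import Relation.Unary using (Pred; Decidable)
open import Relation.Binary.Definitions using (tri<; tri≈; tri>)
open import Relation.Binary.PropositionalEquality as ≡ using (_≡_; _≢_)
open import Algebra.Bundles using (CommutativeMonoid; CommutativeRing; Monoid)
import Algebra.Solver.Ring.AlmostCommutativeRing as ACR

-- With coefficients in ℤ (mapped canonically into R) the library's ring solver can evaluate
-- constants such as -1 · -1; with coefficients in an abstract R it cannot.
module IntegerCoefficientSolver {c ℓ : Level} (R : CommutativeRing c ℓ) where
  open CommutativeRing R
  open import Relation.Binary.Reasoning.Setoid setoid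
  open import Algebra.Properties.Ring ring using (-‿distribˡ-*; -‿distribʳ-*)
  open import Algebra.Properties.Group +-group using (⁻¹-involutive; ε⁻¹≈ε)
  open import Algebra.Properties.AbelianGroup +-abelianGroup using (⁻¹-∙-comm)
  open import Algebra.Properties.Semiring.Mult.TCOptimised semiring
    using (×-homo-+; ×1-homo-*; 1+×) renaming (_×_ to _·_)

  ⟦_⟧ : ℤ → Carrier
  ⟦ ℤ.+ n ⟧    = n · 1#
  ⟦ -[1+ n ] ⟧ = - (suc n · 1#)

  private
    signed : Sign → Carrier → Carrier
    signed Sign.+ x = x
    signed Sign.- x = - x

    signed-cong : ∀ s {x y} → x ≈ y → signed s x ≈ signed s y
    signed-cong Sign.+ e = e
    signed-cong Sign.- e = -‿cong e

    ⟦⟧-signed : ∀ i → ⟦ i ⟧ ≈ signed (sign i) (∣ i ∣ · 1#)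
    ⟦⟧-signed (ℤ.+ n)  = refl
    ⟦⟧-signed -[1+ n ] = refl

    ⟦◃⟧ : ∀ s n → ⟦ s ◃ n ⟧ ≈ signed s (n · 1#)
    ⟦◃⟧ Sign.+ zero    = refl
    ⟦◃⟧ Sign.- zero    = sym ε⁻¹≈ε
    ⟦◃⟧ Sign.+ (suc n) = refl
    ⟦◃⟧ Sign.- (suc n) = refl

    signed-* : ∀ s t a b → signed (s Sign.* t) (a * b) ≈ signed s a * signed t b
    signed-* Sign.+ Sign.+ a b = refl
    signed-* Sign.+ Sign.- a b = -‿distribʳ-* a b
    signed-* Sign.- Sign.+ a b = -‿distribˡ-* a b
    signed-* Sign.- Sign.- a b = begin
      a * b           ≈⟨ *-congʳ (⁻¹-involutive a) ⟨
      (- (- a)) * b   ≈⟨ -‿distribˡ-* (- a) b ⟨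
      - ((- a) * b)   ≈⟨ -‿distribʳ-* (- a) b ⟩
      - a * - b       ∎

    1+m-1+n : ∀ m n → m · 1# + - (n · 1#) ≈ suc m · 1# + - (suc n · 1#)
    1+m-1+n m n = begin
      M + - N                   ≈⟨ +-identityˡ _ ⟨
      0# + (M + - N)            ≈⟨ +-congʳ (-‿inverseʳ 1#) ⟨
      (1# + - 1#) + (M + - N)   ≈⟨ +-assoc _ _ _ ⟩
      1# + (- 1# + (M + - N))   ≈⟨ +-congˡ (+-assoc _ _ _) ⟨
      1# + ((- 1# + M) + - N)   ≈⟨ +-congˡ (+-congʳ (+-comm _ _)) ⟩
      1# + ((M + - 1#) + - N)   ≈⟨ +-congˡ (+-assoc _ _ _) ⟩
      1# + (M + (- 1# + - N))   ≈⟨ +-assoc _ _ _ ⟨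
      (1# + M) + (- 1# + - N)   ≈⟨ +-congˡ (⁻¹-∙-comm _ _) ⟩
      (1# + M) + - (1# + N)     ≈⟨ +-cong (1+× m 1#) (-‿cong (1+× n 1#)) ⟨
      suc m · 1# + - (suc n · 1#) ∎
      where
      M = m · 1#
      N = n · 1#

    ⟦⊖⟧ : ∀ m n → ⟦ m ⊖ n ⟧ ≈ m · 1# + - (n · 1#)
    ⟦⊖⟧ m zero = begin
      ⟦ m ⊖ 0 ⟧       ≡⟨ ≡.cong ⟦_⟧ (ℤ.⊖-≥ {m} {0} ℕ.z≤n) ⟩
      m · 1#          ≈⟨ +-identityʳ _ ⟨
      m · 1# + 0#     ≈⟨ +-congˡ ε⁻¹≈ε ⟨
      m · 1# + - 0#   ∎
    ⟦⊖⟧ zero (suc n) = sym (+-identityˡ _)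
    ⟦⊖⟧ (suc m) (suc n) = begin
      ⟦ suc m ⊖ suc n ⟧             ≡⟨ ≡.cong ⟦_⟧ (ℤ.[1+m]⊖[1+n]≡m⊖n m n) ⟩
      ⟦ m ⊖ n ⟧                     ≈⟨ ⟦⊖⟧ m n ⟩
      m · 1# + - (n · 1#)           ≈⟨ 1+m-1+n m n ⟩
      suc m · 1# + - (suc n · 1#)   ∎

  ⟦⟧-homo-* : ∀ i j → ⟦ i ℤ.* j ⟧ ≈ ⟦ i ⟧ * ⟦ j ⟧
  ⟦⟧-homo-* i j = begin
    ⟦ s ◃ (∣ i ∣ ℕ.* ∣ j ∣) ⟧                      ≈⟨ ⟦◃⟧ s (∣ i ∣ ℕ.* ∣ j ∣) ⟩
    signed s ((∣ i ∣ ℕ.* ∣ j ∣) · 1#)              ≈⟨ signed-cong s (×1-homo-* ∣ i ∣ ∣ j ∣) ⟩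
    signed s ((∣ i ∣ · 1#) * (∣ j ∣ · 1#))         ≈⟨ signed-* (sign i) (sign j) _ _ ⟩
    signed (sign i) (∣ i ∣ · 1#) * signed (sign j) (∣ j ∣ · 1#) ≈⟨ *-cong (⟦⟧-signed i) (⟦⟧-signed j) ⟨
    ⟦ i ⟧ * ⟦ j ⟧                                  ∎
    where s = sign i Sign.* sign j

  ⟦⟧-homo-- : ∀ i → ⟦ ℤ.- i ⟧ ≈ - ⟦ i ⟧
  ⟦⟧-homo-- (ℤ.+ zero)  = sym ε⁻¹≈ε
  ⟦⟧-homo-- (ℤ.+ suc n) = refl
  ⟦⟧-homo-- -[1+ n ]    = sym (⁻¹-involutive _)

  ⟦⟧-homo-+ : ∀ i j → ⟦ i ℤ.+ j ⟧ ≈ ⟦ i ⟧ + ⟦ j ⟧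
  ⟦⟧-homo-+ (ℤ.+ m)  (ℤ.+ n)  = ×-homo-+ 1# m n
  ⟦⟧-homo-+ (ℤ.+ m)  -[1+ n ] = ⟦⊖⟧ m (suc n)
  ⟦⟧-homo-+ -[1+ m ] (ℤ.+ n)  = trans (⟦⊖⟧ n (suc m)) (+-comm _ _)
  ⟦⟧-homo-+ -[1+ m ] -[1+ n ] = begin
    - (suc (suc (m ℕ.+ n)) · 1#)      ≡⟨ ≡.cong (λ k → - (k · 1#)) (≡.sym (ℕ.+-suc (suc m) n)) ⟩
    - ((suc m ℕ.+ suc n) · 1#)        ≈⟨ -‿cong (×-homo-+ 1# (suc m) (suc n)) ⟩
    - (suc m · 1# + suc n · 1#)       ≈⟨ ⁻¹-∙-comm _ _ ⟨
    - (suc m · 1#) + - (suc n · 1#)   ∎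

  private
    almostCommutativeRing : ACR.AlmostCommutativeRing c ℓ
    almostCommutativeRing = ACR.fromCommutativeRing R

    ℤ⟶R : ℤ.+-*-rawRing ACR.-Raw-AlmostCommutative⟶ almostCommutativeRing
    ℤ⟶R = record
      { ⟦_⟧ = ⟦_⟧ ; +-homo = ⟦⟧-homo-+ ; *-homo = ⟦⟧-homo-* ; -‿homo = ⟦⟧-homo--
      ; 0-homo = refl ; 1-homo = refl }

    ⟦⟧-≟ : ∀ i j → Maybe (⟦ i ⟧ ≈ ⟦ j ⟧)
    ⟦⟧-≟ i j with i ℤ.≟ j
    ... | yes ≡.refl = just refl
    ... | no _       = nothing

  open import Algebra.Solver.Ring ℤ.+-*-rawRing almostCommutativeRing ℤ⟶R ⟦⟧-≟ public
    using (Polynomial; solve; _:=_; _:+_; _:*_; _:-_; :-_; con)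

  :0 :1 : ∀ {n} → Polynomial n
  :0 = con (ℤ.+ 0)
  :1 = con (ℤ.+ 1)

module _ {A : Set} where

  private
    ∈-++-middle : (ys zs : List A) {x : A} → x ∈ ys ++ x ∷ zs
    ∈-++-middle []       zs = here ≡.refl
    ∈-++-middle (_ ∷ ys) zs = there (∈-++-middle ys zs)

  ∈-deleteMiddle : (ys zs : List A) {x v : A} → v ∈ ys ++ x ∷ zs → v ≢ x → v ∈ ys ++ zs
  ∈-deleteMiddle []       zs (here e)   v≢x = ⊥-elim (v≢x e)
  ∈-deleteMiddle []       zs (there v∈) _   = v∈
  ∈-deleteMiddle (y ∷ ys) zs (here e)   _   = here e
  ∈-deleteMiddle (y ∷ ys) zs (there v∈) v≢x = there (∈-deleteMiddle ys zs v∈ v≢x)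

  ∈-insertMiddle : (ys zs : List A) {x v : A} → v ∈ ys ++ zs → v ∈ ys ++ x ∷ zs
  ∈-insertMiddle []       zs v∈         = there v∈
  ∈-insertMiddle (y ∷ ys) zs (here e)   = here e
  ∈-insertMiddle (y ∷ ys) zs (there v∈) = there (∈-insertMiddle ys zs v∈)

  unique-middle-∉ : (ys zs : List A) {x v : A} → Unique (ys ++ x ∷ zs) → v ∈ ys ++ zs → v ≢ x
  unique-middle-∉ []       zs (x∉ ∷ _) v∈            ≡.refl = All.lookup x∉ v∈ ≡.refl
  unique-middle-∉ (y ∷ ys) zs (y∉ ∷ _) (here ≡.refl) ≡.refl = All.lookup y∉ (∈-++-middle ys zs) ≡.refl
  unique-middle-∉ (y ∷ ys) zs (_ ∷ u)  (there v∈)    v≡x    = unique-middle-∉ ys zs u v∈ v≡x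

  unique-deleteMiddle : (ys zs : List A) {x : A} → Unique (ys ++ x ∷ zs) → Unique (ys ++ zs)
  unique-deleteMiddle []       zs (_ ∷ u)  = u
  unique-deleteMiddle (y ∷ ys) zs (y∉ ∷ u) = delete ys y∉ ∷ unique-deleteMiddle ys zs u
    where
    delete : (ys : List A) {x : A} → All (y ≢_) (ys ++ x ∷ zs) → All (y ≢_) (ys ++ zs)
    delete []       (_ ∷ ne) = ne
    delete (_ ∷ ys) (n ∷ ne) = n ∷ delete ys ne

module FoldOverUniqueLists {c ℓ : Level} (M : CommutativeMonoid c ℓ) {A : Set}
                           (f : A → CommutativeMonoid.Carrier M) where
  open CommutativeMonoid M
  open import Relation.Binary.Reasoning.Setoid setoid

  fold : List A → Carrier
  fold = foldr (λ a r → f a ∙ r) ε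

  fold-middle : (ys zs : List A) (x : A) → fold (ys ++ x ∷ zs) ≈ f x ∙ fold (ys ++ zs)
  fold-middle []       zs x = refl
  fold-middle (y ∷ ys) zs x = begin
    f y ∙ fold (ys ++ x ∷ zs)       ≈⟨ ∙-congˡ (fold-middle ys zs x) ⟩
    f y ∙ (f x ∙ fold (ys ++ zs))   ≈⟨ assoc _ _ _ ⟨
    (f y ∙ f x) ∙ fold (ys ++ zs)   ≈⟨ ∙-congʳ (comm _ _) ⟩
    (f x ∙ f y) ∙ fold (ys ++ zs)   ≈⟨ assoc _ _ _ ⟩
    f x ∙ (f y ∙ fold (ys ++ zs))   ∎

  fold-sameElements : (xs ys : List A) → Unique xs → Unique ys →
                      (∀ z → z ∈ xs → z ∈ ys) → (∀ z → z ∈ ys → z ∈ xs) → fold xs ≈ fold ys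
  fold-sameElements []       []       _ _ _ _ = refl
  fold-sameElements []       (y ∷ ys) _ _ _ ys⊆[] with () ← ys⊆[] y (here ≡.refl)
  fold-sameElements (x ∷ xs) ys (x∉ ∷ uxs) uys xs⊆ys ys⊆xs with ∈-∃++ (xs⊆ys x (here ≡.refl))
  ... | ys₁ , ys₂ , ≡.refl = begin
    f x ∙ fold xs               ≈⟨ ∙-congˡ (fold-sameElements xs (ys₁ ++ ys₂) uxs (unique-deleteMiddle ys₁ ys₂ uys) ⊆ ⊇) ⟩
    f x ∙ fold (ys₁ ++ ys₂)     ≈⟨ fold-middle ys₁ ys₂ x ⟨
    fold (ys₁ ++ x ∷ ys₂)       ∎
    where
    ⊆ : ∀ z → z ∈ xs → z ∈ ys₁ ++ ys₂
    ⊆ z z∈ = ∈-deleteMiddle ys₁ ys₂ (xs⊆ys z (there z∈)) (λ z≡x → All.lookup x∉ z∈ (≡.sym z≡x))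
    ⊇ : ∀ z → z ∈ ys₁ ++ ys₂ → z ∈ xs
    ⊇ z z∈ with ys⊆xs z (∈-insertMiddle ys₁ ys₂ z∈)
    ... | here z≡x  = ⊥-elim (unique-middle-∉ ys₁ ys₂ uys z∈ z≡x)
    ... | there z∈′ = z∈′

module HomomorphismFromℕ {c ℓ : Level} (M : Monoid c ℓ) (φ : ℕ → Monoid.Carrier M)
         (φ-0 : Monoid._≈_ M (φ 0) (Monoid.ε M))
         (φ-+ : ∀ a b → Monoid._≈_ M (φ (a ℕ.+ b)) (Monoid._∙_ M (φ a) (φ b))) where
  open Monoid M
  open import Relation.Binary.Reasoning.Setoid setoid

  φ-multiple : ∀ k m → φ k ≈ ε → φ (m ℕ.* k) ≈ ε
  φ-multiple k zero    φk≈ε = φ-0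
  φ-multiple k (suc m) φk≈ε = begin
    φ (k ℕ.+ m ℕ.* k)       ≈⟨ φ-+ k (m ℕ.* k) ⟩
    φ k ∙ φ (m ℕ.* k)       ≈⟨ ∙-cong φk≈ε (φ-multiple k m φk≈ε) ⟩
    ε ∙ ε                   ≈⟨ identityˡ ε ⟩
    ε                       ∎

  φ-+-kernel : ∀ u k → φ k ≈ ε → φ (u ℕ.+ k) ≈ φ u
  φ-+-kernel u k φk≈ε = begin
    φ (u ℕ.+ k)   ≈⟨ φ-+ u k ⟩
    φ u ∙ φ k     ≈⟨ ∙-congˡ φk≈ε ⟩
    φ u ∙ ε       ≈⟨ identityʳ _ ⟩
    φ u           ∎

  φ-% : ∀ p .{{_ : ℕ.NonZero p}} → φ p ≈ ε → ∀ u → φ u ≈ φ (u % p)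
  φ-% p φp≈ε u = begin
    φ u                           ≡⟨ ≡.cong φ (m≡m%n+[m/n]*n u p) ⟩
    φ (u % p ℕ.+ (u / p) ℕ.* p)   ≈⟨ φ-+-kernel (u % p) _ (φ-multiple p (u / p) φp≈ε) ⟩
    φ (u % p)                     ∎

  φ-1≈ε : ∀ p k → Prime p → φ p ≈ ε → φ k ≈ ε → 0 ℕ.< k → k ℕ.< p → φ 1 ≈ ε
  φ-1≈ε p (suc k) p-prime φp≈ε φk≈ε _ k<p with coprime-Bézout (prime⇒coprime p-prime k<p)
  ... | Bézout.+- x y 1+yk≡xp = begin
    φ 1                       ≈⟨ φ-+-kernel 1 _ (φ-multiple (suc k) y φk≈ε) ⟨
    φ (1 ℕ.+ y ℕ.* suc k)     ≡⟨ ≡.cong φ 1+yk≡xp ⟩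
    φ (x ℕ.* p)               ≈⟨ φ-multiple p x φp≈ε ⟩
    ε                         ∎
  ... | Bézout.-+ x y 1+xp≡yk = begin
    φ 1                       ≈⟨ φ-+-kernel 1 _ (φ-multiple p x φp≈ε) ⟨
    φ (1 ℕ.+ x ℕ.* p)         ≡⟨ ≡.cong φ 1+xp≡yk ⟩
    φ (y ℕ.* suc k)           ≈⟨ φ-multiple (suc k) y φk≈ε ⟩
    ε                         ∎

[1+k]*[1+n]C[1+k]≡[1+n]*nCk : ∀ n k → suc k ℕ.* (suc n C suc k) ≡ suc n ℕ.* (n C k)
[1+k]*[1+n]C[1+k]≡[1+n]*nCk zero    zero    = ≡.refl
[1+k]*[1+n]C[1+k]≡[1+n]*nCk zero    (suc k) = ℕ.*-zeroʳ (suc (suc k))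
[1+k]*[1+n]C[1+k]≡[1+n]*nCk (suc m) zero    =
  ≡.trans (ℕ.+-identityʳ _) (≡.trans (nC1≡n (suc (suc m))) (≡.sym (ℕ.*-identityʳ _)))
[1+k]*[1+n]C[1+k]≡[1+n]*nCk (suc m) (suc j) = begin
  suc (suc j) ℕ.* (suc (suc m) C suc (suc j))              ≡⟨ ≡.cong (suc (suc j) ℕ.*_) (nCk+nC[k+1]≡[n+1]C[k+1] (suc m) (suc j)) ⟨
  suc (suc j) ℕ.* (a ℕ.+ b)                                ≡⟨ solve 3 (λ j a b → (con 2 :+ j) :* (a :+ b) := a :+ (con 1 :+ j) :* a :+ (con 2 :+ j) :* b) ≡.refl j a b ⟩
  a ℕ.+ suc j ℕ.* a ℕ.+ suc (suc j) ℕ.* b                  ≡⟨ ≡.cong₂ (λ u v → a ℕ.+ u ℕ.+ v) ([1+k]*[1+n]C[1+k]≡[1+n]*nCk m j) ([1+k]*[1+n]C[1+k]≡[1+n]*nCk m (suc j)) ⟩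
  a ℕ.+ suc m ℕ.* (m C j) ℕ.+ suc m ℕ.* (m C suc j)        ≡⟨ solve 4 (λ a n u v → a :+ n :* u :+ n :* v := a :+ n :* (u :+ v)) ≡.refl a (suc m) (m C j) (m C suc j) ⟩
  a ℕ.+ suc m ℕ.* (m C j ℕ.+ m C suc j)                    ≡⟨ ≡.cong (λ u → a ℕ.+ suc m ℕ.* u) (nCk+nC[k+1]≡[n+1]C[k+1] m j) ⟩
  suc (suc m) ℕ.* a                                        ∎
  where
  open ≡.≡-Reasoning
  open import Data.Nat.Solver using (module +-*-Solver)
  open +-*-Solver
  a = suc m C suc j
  b = suc m C suc (suc j)

p∣pCk : ∀ p k → Prime p → 0 ℕ.< k → k ℕ.< p → p ∣ (p C k)
p∣pCk (suc n) (suc j) p-prime _ k<p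
  with euclidsLemma (suc j) (suc n C suc j) p-prime
         (divides (n C j) (≡.trans ([1+k]*[1+n]C[1+k]≡[1+n]*nCk n j) (ℕ.*-comm (suc n) (n C j))))
... | inj₁ p∣k    = ⊥-elim (ℕ.<⇒≱ k<p (∣⇒≤ p∣k))
... | inj₂ p∣pCk′ = p∣pCk′

-- The partial sums in Tr and the search in trℕ are local functions of Defs, not in scope here;
-- each is named by a metavariable that unification solves with it (abstracting n, resp. p, first).
mutual
  partialTrace : (𝔽 : FiniteField) → FiniteField.F 𝔽 → ℕ → FiniteField.F 𝔽
  partialTrace = _

  partialTrace-n : (𝔽 : FiniteField) (x : FiniteField.F 𝔽) →
                   partialTrace 𝔽 x (FiniteField.n 𝔽) ≡ FiniteField.Tr 𝔽 x
  partialTrace-n 𝔽 x with FiniteField.n 𝔽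
  ... | _ = ≡.refl

  traceSearch : (𝔽 : FiniteField) → FiniteField.F 𝔽 → ℕ → ℕ
  traceSearch = _

  traceSearch-p : (𝔽 : FiniteField) (x : FiniteField.F 𝔽) →
                  traceSearch 𝔽 x (FiniteField.p 𝔽) ≡ FiniteField.trℕ 𝔽 x
  traceSearch-p 𝔽 x with FiniteField.p 𝔽
  ... | _ = ≡.refl

module FieldProperties (𝔽 : FiniteField) where
  open ≡ using (refl; sym; trans; cong; cong₂; subst)
  open ≡.≡-Reasoning
  open FiniteField 𝔽 public

  ring : CommutativeRing 0ℓ 0ℓ
  ring = record { isCommutativeRing = isCommRing }

  open CommutativeRing ring public
    using (*-comm; *-assoc; +-comm; +-assoc; zeroˡ; zeroʳ; *-identityˡ; *-identityʳ;
           +-identityˡ; +-identityʳ; -‿inverseʳ)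
  open IntegerCoefficientSolver ring public

  1≢0 : 1# ≢ 0#
  1≢0 1≡0 = 0≢1 (sym 1≡0)

  inv-l : ∀ x → x ≢ 0# → inv x * x ≡ 1#
  inv-l x x≢0 = trans (*-comm _ _) (inv-r x x≢0)

  inv-cancelˡ : ∀ a x → a ≢ 0# → a * (inv a * x) ≡ x
  inv-cancelˡ a x a≢0 = trans (sym (*-assoc _ _ _)) (trans (cong (_* x) (inv-r a a≢0)) (*-identityˡ x))

  inv-cancelʳ : ∀ a x → a ≢ 0# → inv a * (a * x) ≡ x
  inv-cancelʳ a x a≢0 = trans (sym (*-assoc _ _ _)) (trans (cong (_* x) (inv-l a a≢0)) (*-identityˡ x))

  *-cancelˡ : ∀ a {x y} → a ≢ 0# → a * x ≡ a * y → x ≡ y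
  *-cancelˡ a {x} {y} a≢0 ax≡ay = begin
    x                 ≡⟨ inv-cancelʳ a x a≢0 ⟨
    inv a * (a * x)   ≡⟨ cong (inv a *_) ax≡ay ⟩
    inv a * (a * y)   ≡⟨ inv-cancelʳ a y a≢0 ⟩
    y                 ∎

  zero-divisor : ∀ a b → a * b ≡ 0# → a ≡ 0# ⊎ b ≡ 0#
  zero-divisor a b ab≡0 with a ≟ 0#
  ... | yes a≡0 = inj₁ a≡0
  ... | no a≢0  = inj₂ (*-cancelˡ a a≢0 (trans ab≡0 (sym (zeroʳ a))))

  *-≢0 : ∀ {a b} → a ≢ 0# → b ≢ 0# → a * b ≢ 0#
  *-≢0 {a} {b} a≢0 b≢0 ab≡0 with zero-divisor a b ab≡0
  ... | inj₁ a≡0 = a≢0 a≡0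
  ... | inj₂ b≡0 = b≢0 b≡0

  inv-≢0 : ∀ a → a ≢ 0# → inv a ≢ 0#
  inv-≢0 a a≢0 inva≡0 = 1≢0 (trans (sym (inv-r a a≢0)) (trans (cong (a *_) inva≡0) (zeroʳ a)))

  inv-unique : ∀ a b → a * b ≡ 1# → inv a ≡ b
  inv-unique a b ab≡1 = *-cancelˡ a a≢0 (trans (inv-r a a≢0) (sym ab≡1))
    where
    a≢0 : a ≢ 0#
    a≢0 a≡0 = 0≢1 (trans (sym (zeroˡ b)) (trans (cong (_* b) (sym a≡0)) ab≡1))

  inv-involutive : ∀ a → inv (inv a) ≡ a
  inv-involutive a with a ≟ 0#
  ... | yes refl = trans (cong inv inv-0) inv-0
  ... | no a≢0  = inv-unique (inv a) a (inv-l a a≢0)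

  inv-distrib-* : ∀ a b → inv (a * b) ≡ inv a * inv b
  inv-distrib-* a b with a ≟ 0# | b ≟ 0#
  ... | yes refl | _ = begin
    inv (0# * b)      ≡⟨ cong inv (zeroˡ b) ⟩
    inv 0#            ≡⟨ inv-0 ⟩
    0#                ≡⟨ zeroˡ (inv b) ⟨
    0# * inv b        ≡⟨ cong (_* inv b) inv-0 ⟨
    inv 0# * inv b    ∎
  ... | no _ | yes refl = begin
    inv (a * 0#)      ≡⟨ cong inv (zeroʳ a) ⟩
    inv 0#            ≡⟨ inv-0 ⟩
    0#                ≡⟨ zeroʳ (inv a) ⟨
    inv a * 0#        ≡⟨ cong (inv a *_) inv-0 ⟨
    inv a * inv 0#    ∎
  ... | no a≢0 | no b≢0 = inv-unique (a * b) (inv a * inv b) (begin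
    (a * b) * (inv a * inv b)     ≡⟨ solve 4 (λ a b i j → (a :* b) :* (i :* j) := (a :* i) :* (b :* j)) refl a b (inv a) (inv b) ⟩
    (a * inv a) * (b * inv b)     ≡⟨ cong₂ _*_ (inv-r a a≢0) (inv-r b b≢0) ⟩
    1# * 1#                       ≡⟨ *-identityˡ 1# ⟩
    1#                            ∎)

  inv-[-1] : inv (- 1#) ≡ - 1#
  inv-[-1] = inv-unique (- 1#) (- 1#) (solve 0 (:- :1 :* :- :1 := :1) refl)

  -1*[x-1]≡1-x : ∀ x → (- 1#) * (x - 1#) ≡ 1# - x
  -1*[x-1]≡1-x = solve 1 (λ x → :- :1 :* (x :- :1) := :1 :- x) refl

  1-[1-x]≡x : ∀ x → 1# - (1# - x) ≡ x
  1-[1-x]≡x = solve 1 (λ x → :1 :- (:1 :- x) := x) refl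

  1-0≢0 : 1# - 0# ≢ 0#
  1-0≢0 = subst (_≢ 0#) (solve 0 (:1 := :1 :- :0) refl) 1≢0

  x-y≡0⇒x≡y : ∀ x y → x - y ≡ 0# → x ≡ y
  x-y≡0⇒x≡y x y x-y≡0 = begin
    x              ≡⟨ solve 2 (λ x y → x := (x :- y) :+ y) refl x y ⟩
    (x - y) + y    ≡⟨ cong (_+ y) x-y≡0 ⟩
    0# + y         ≡⟨ +-identityˡ y ⟩
    y              ∎

  x+y≡x⇒y≡0 : ∀ x y → x + y ≡ x → y ≡ 0#
  x+y≡x⇒y≡0 x y x+y≡x = begin
    y              ≡⟨ solve 2 (λ x y → y := (x :+ y) :- x) refl x y ⟩
    (x + y) - x    ≡⟨ cong (_- x) x+y≡x ⟩
    x - x          ≡⟨ -‿inverseʳ x ⟩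
    0#             ∎

  ^-+ : ∀ x a b → x ^ (a ℕ.+ b) ≡ x ^ a * x ^ b
  ^-+ x zero    b = sym (*-identityˡ _)
  ^-+ x (suc a) b = trans (cong (x *_) (^-+ x a b)) (sym (*-assoc _ _ _))

  ^-distrib-* : ∀ x y n → (x * y) ^ n ≡ x ^ n * y ^ n
  ^-distrib-* x y zero    = sym (*-identityˡ 1#)
  ^-distrib-* x y (suc n) = trans (cong ((x * y) *_) (^-distrib-* x y n))
    (solve 4 (λ x y a b → (x :* y) :* (a :* b) := (x :* a) :* (y :* b)) refl x y (x ^ n) (y ^ n))

  1^n≡1 : ∀ n → 1# ^ n ≡ 1#
  1^n≡1 zero    = refl
  1^n≡1 (suc n) = trans (*-identityˡ _) (1^n≡1 n)

  ^-* : ∀ x a b → x ^ (a ℕ.* b) ≡ (x ^ a) ^ b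
  ^-* x zero    b = sym (1^n≡1 b)
  ^-* x (suc a) b = begin
    x ^ (b ℕ.+ a ℕ.* b)       ≡⟨ ^-+ x b (a ℕ.* b) ⟩
    x ^ b * x ^ (a ℕ.* b)     ≡⟨ cong (x ^ b *_) (^-* x a b) ⟩
    x ^ b * (x ^ a) ^ b       ≡⟨ ^-distrib-* x (x ^ a) b ⟨
    (x * x ^ a) ^ b           ∎

module PrimeSubfield (𝔽 : FiniteField) where
  open ≡ using (refl; sym; trans; cong; cong₂; subst)
  open ≡.≡-Reasoning
  open FieldProperties 𝔽

  instance
    p-nonZero : ℕ.NonZero p
    p-nonZero = prime⇒nonZero p-prime

  1<p : 1 ℕ.< p
  1<p = ℕ.nonTrivial⇒n>1 p {{prime⇒nonTrivial p-prime}}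

  ⟨_⟩ : ℕ → F
  ⟨ k ⟩ = natMul 0# _+_ k 1#

  ⟨⟩-+ : ∀ a b → ⟨ a ℕ.+ b ⟩ ≡ ⟨ a ⟩ + ⟨ b ⟩
  ⟨⟩-+ zero    b = sym (+-identityˡ _)
  ⟨⟩-+ (suc a) b = trans (cong (1# +_) (⟨⟩-+ a b)) (sym (+-assoc _ _ _))

  ⟨⟩-* : ∀ a b → ⟨ a ℕ.* b ⟩ ≡ ⟨ a ⟩ * ⟨ b ⟩
  ⟨⟩-* zero    b = sym (zeroˡ _)
  ⟨⟩-* (suc a) b = begin
    ⟨ b ℕ.+ a ℕ.* b ⟩             ≡⟨ ⟨⟩-+ b (a ℕ.* b) ⟩
    ⟨ b ⟩ + ⟨ a ℕ.* b ⟩           ≡⟨ cong (⟨ b ⟩ +_) (⟨⟩-* a b) ⟩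
    ⟨ b ⟩ + ⟨ a ⟩ * ⟨ b ⟩         ≡⟨ solve 2 (λ x y → x :+ y :* x := (:1 :+ y) :* x) refl ⟨ b ⟩ ⟨ a ⟩ ⟩
    (1# + ⟨ a ⟩) * ⟨ b ⟩          ∎

  private
    module ⟨⟩-Hom = HomomorphismFromℕ (CommutativeRing.+-monoid ring) ⟨_⟩ refl ⟨⟩-+

  ⟨⟩-≢0 : ∀ d → 0 ℕ.< d → d ℕ.< p → ⟨ d ⟩ ≢ 0#
  ⟨⟩-≢0 d 0<d d<p ⟨d⟩≡0 = 1≢0 (trans (sym (+-identityʳ 1#)) (⟨⟩-Hom.φ-1≈ε p d p-prime char-p ⟨d⟩≡0 0<d d<p))

  ⟨⟩-<-distinct : ∀ {a b} → a ℕ.< b → b ℕ.< p → ⟨ a ⟩ ≢ ⟨ b ⟩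
  ⟨⟩-<-distinct {a} {b} a<b b<p ⟨a⟩≡⟨b⟩ =
    ⟨⟩-≢0 (b ℕ.∸ a) (ℕ.m<n⇒0<n∸m a<b) (ℕ.≤-<-trans (ℕ.m∸n≤m b a) b<p)
      (x+y≡x⇒y≡0 ⟨ a ⟩ _ (trans (sym (⟨⟩-+ a (b ℕ.∸ a))) (trans (cong ⟨_⟩ (ℕ.m+[n∸m]≡n (ℕ.<⇒≤ a<b))) (sym ⟨a⟩≡⟨b⟩))))

  ⟨⟩-injective : ∀ a b → a ℕ.< p → b ℕ.< p → ⟨ a ⟩ ≡ ⟨ b ⟩ → a ≡ b
  ⟨⟩-injective a b a<p b<p ⟨a⟩≡⟨b⟩ with ℕ.<-cmp a b
  ... | tri≈ _ a≡b _ = a≡b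
  ... | tri< a<b _ _ = ⊥-elim (⟨⟩-<-distinct a<b b<p ⟨a⟩≡⟨b⟩)
  ... | tri> _ _ b<a = ⊥-elim (⟨⟩-<-distinct b<a a<p (sym ⟨a⟩≡⟨b⟩))

  ⟨⟩-≡⇒%-≡ : ∀ u v → ⟨ u ⟩ ≡ ⟨ v ⟩ → u % p ≡ v % p
  ⟨⟩-≡⇒%-≡ u v ⟨u⟩≡⟨v⟩ = ⟨⟩-injective (u % p) (v % p) (m%n<n u p) (m%n<n v p)
    (trans (sym (⟨⟩-Hom.φ-% p char-p u)) (trans ⟨u⟩≡⟨v⟩ (⟨⟩-Hom.φ-% p char-p v)))

  private
    open import Algebra.Properties.Semiring.Exp (CommutativeRing.semiring ring) using () renaming (_^_ to _^ₛ_)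
    open import Algebra.Properties.Semiring.Mult (CommutativeRing.semiring ring) using () renaming (_×_ to _·_)
    open import Algebra.Properties.Monoid.Sum (CommutativeRing.+-monoid ring) using (sum)
    import Algebra.Properties.CommutativeSemiring.Binomial (CommutativeRing.commutativeSemiring ring) as Binomial

    ^≡^ₛ : ∀ x n → x ^ n ≡ x ^ₛ n
    ^≡^ₛ x zero    = refl
    ^≡^ₛ x (suc n) = cong (x *_) (^≡^ₛ x n)

    ·≡⟨⟩* : ∀ n z → n · z ≡ ⟨ n ⟩ * z
    ·≡⟨⟩* zero    z = sym (zeroˡ z)
    ·≡⟨⟩* (suc n) z = trans (cong (z +_) (·≡⟨⟩* n z)) (solve 2 (λ z c → z :+ c :* z := (:1 :+ c) :* z) refl z ⟨ n ⟩)

    sum-last : ∀ m (g : Fin (suc m) → F) → (∀ j → g (inject₁ j) ≡ 0#) → sum g ≡ g (fromℕ m)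
    sum-last zero    g g≡0 = +-identityʳ _
    sum-last (suc m) g g≡0 =
      trans (cong₂ _+_ (g≡0 fzero) (sum-last m (λ j → g (fsuc j)) (λ j → g≡0 (fsuc j)))) (+-identityˡ _)

    freshmansDream : ∀ N → 1 ℕ.< N → (∀ k → 0 ℕ.< k → k ℕ.< N → ⟨ N C k ⟩ ≡ 0#) →
               ∀ a b → (a + b) ^ N ≡ a ^ N + b ^ N
    freshmansDream (suc zero) (ℕ.s≤s ()) _ a b
    freshmansDream (suc (suc m)) _ NCk≡0 a b = begin
      (a + b) ^ N                               ≡⟨ ^≡^ₛ (a + b) N ⟩
      (a + b) ^ₛ N                              ≡⟨ Binomial.theorem N a b ⟩
      sum term                                  ≡⟨ cong (term fzero +_) (sum-last (suc m) (λ j → term (fsuc j)) inner) ⟩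
      term fzero + term (fsuc (fromℕ (suc m)))  ≡⟨ cong₂ _+_ first last ⟩
      b ^ N + a ^ N                             ≡⟨ +-comm _ _ ⟩
      a ^ N + b ^ N                             ∎
      where
      N = suc (suc m)
      term : Fin (suc N) → F
      term = Binomial.binomialTerm a b N
      term′ : ℕ → F
      term′ t = (N C t) · ((a ^ₛ t) * (b ^ₛ (N ℕ.∸ t)))
      inner : ∀ j → term (fsuc (inject₁ j)) ≡ 0#
      inner j = begin
        term′ (suc t)           ≡⟨ ·≡⟨⟩* (N C suc t) _ ⟩
        ⟨ N C suc t ⟩ * w       ≡⟨ cong (_* w) (NCk≡0 (suc t) (ℕ.s≤s ℕ.z≤n) t<m) ⟩
        0# * w                  ≡⟨ zeroˡ _ ⟩
        0#                      ∎
        where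
        t = toℕ (inject₁ j)
        w = (a ^ₛ suc t) * (b ^ₛ (N ℕ.∸ suc t))
        t<m : suc t ℕ.< N
        t<m = ℕ.s≤s (subst (ℕ._< suc m) (sym (toℕ-inject₁ j)) (toℕ<n j))
      first : term fzero ≡ b ^ N
      first = begin
        term′ 0                                ≡⟨ ·≡⟨⟩* (N C 0) _ ⟩
        ⟨ 1 ⟩ * (1# * (b ^ₛ N))                 ≡⟨ solve 1 (λ z → (:1 :+ :0) :* (:1 :* z) := z) refl (b ^ₛ N) ⟩
        b ^ₛ N                                 ≡⟨ ^≡^ₛ b N ⟨
        b ^ N                                  ∎
      last : term (fsuc (fromℕ (suc m))) ≡ a ^ N
      last = begin
        term′ (suc (toℕ (fromℕ (suc m))))      ≡⟨ cong (λ t → term′ (suc t)) (toℕ-fromℕ (suc m)) ⟩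
        term′ N                                ≡⟨ ·≡⟨⟩* (N C N) _ ⟩
        ⟨ N C N ⟩ * ((a ^ₛ N) * (b ^ₛ (N ℕ.∸ N)))   ≡⟨ cong₂ (λ u v → ⟨ u ⟩ * ((a ^ₛ N) * (b ^ₛ v))) (nCn≡1 N) (ℕ.n∸n≡0 N) ⟩
        ⟨ 1 ⟩ * ((a ^ₛ N) * 1#)                ≡⟨ solve 1 (λ z → (:1 :+ :0) :* (z :* :1) := z) refl (a ^ₛ N) ⟩
        a ^ₛ N                                 ≡⟨ ^≡^ₛ a N ⟨
        a ^ N                                  ∎

  frobenius-+ : ∀ a b → (a + b) ^ p ≡ a ^ p + b ^ p
  frobenius-+ = freshmansDream p 1<p (λ k 0<k k<p → p∣⇒⟨⟩≡0 (p∣pCk p k p-prime 0<k k<p))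
    where
    p∣⇒⟨⟩≡0 : ∀ {m} → p ∣ m → ⟨ m ⟩ ≡ 0#
    p∣⇒⟨⟩≡0 (divides k refl) = trans (⟨⟩-* k p) (trans (cong (⟨ k ⟩ *_) char-p) (zeroʳ _))

  frobenius^-+ : ∀ i a b → (a + b) ^ (p ℕ.^ i) ≡ a ^ (p ℕ.^ i) + b ^ (p ℕ.^ i)
  frobenius^-+ zero    a b = trans (*-identityʳ _) (sym (cong₂ _+_ (*-identityʳ a) (*-identityʳ b)))
  frobenius^-+ (suc i) a b = begin
    (a + b) ^ (p ℕ.* p ℕ.^ i)                   ≡⟨ ^-* (a + b) p (p ℕ.^ i) ⟩
    ((a + b) ^ p) ^ (p ℕ.^ i)                   ≡⟨ cong (_^ (p ℕ.^ i)) (frobenius-+ a b) ⟩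
    (a ^ p + b ^ p) ^ (p ℕ.^ i)                 ≡⟨ frobenius^-+ i (a ^ p) (b ^ p) ⟩
    (a ^ p) ^ (p ℕ.^ i) + (b ^ p) ^ (p ℕ.^ i)   ≡⟨ cong₂ _+_ (^-* a p (p ℕ.^ i)) (^-* b p (p ℕ.^ i)) ⟨
    a ^ (p ℕ.* p ℕ.^ i) + b ^ (p ℕ.* p ℕ.^ i)   ∎

  0^p≡0 : 0# ^ p ≡ 0#
  0^p≡0 with p | 1<p
  ... | suc _ | _ = zeroˡ _

  ⟨⟩^p≡⟨⟩ : ∀ k → ⟨ k ⟩ ^ p ≡ ⟨ k ⟩
  ⟨⟩^p≡⟨⟩ zero    = 0^p≡0
  ⟨⟩^p≡⟨⟩ (suc k) = trans (frobenius-+ 1# ⟨ k ⟩) (cong₂ _+_ (1^n≡1 p) (⟨⟩^p≡⟨⟩ k))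

module Units (𝔽 : FiniteField) where
  open ≡ using (refl; sym; trans; cong; cong₂; subst)
  open ≡.≡-Reasoning
  open FieldProperties 𝔽
  private
    module Product = FoldOverUniqueLists (CommutativeRing.*-commutativeMonoid ring) {F} (λ x → x)

  ≢0? : (x : F) → Dec (x ≢ 0#)
  ≢0? x = ¬? (x ≟ 0#)

  units-≢0 : All (_≢ 0#) units
  units-≢0 = all-filter ≢0? elems

  ∈-units : ∀ {x} → x ≢ 0# → x ∈ units
  ∈-units x≢0 = ∈-filter⁺ ≢0? (complete _) x≢0

  ∈-units⇒≢0 : ∀ {x} → x ∈ units → x ≢ 0#
  ∈-units⇒≢0 x∈ = proj₂ (∈-filter⁻ ≢0? {xs = elems} x∈)

  units-unique : Unique units
  units-unique = filter⁺ ≢0? unique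

  suc-length-units : suc (length units) ≡ q
  suc-length-units = go elems unique (complete 0#)
    where
    go : ∀ xs → Unique xs → 0# ∈ xs → suc (length (filter ≢0? xs)) ≡ length xs
    go (x ∷ xs) (x∉ ∷ u) 0∈ with x ≟ 0#
    ... | yes refl = cong suc (cong length (filter-all ≢0? (All.map (λ x≢y y≡x → x≢y (sym y≡x)) x∉)))
    ... | no x≢0 with 0∈
    ...   | here 0≡x   = ⊥-elim (x≢0 (sym 0≡x))
    ...   | there 0∈xs = cong suc (go xs u 0∈xs)

  private
    product-≢0 : ∀ xs → All (_≢ 0#) xs → Product.fold xs ≢ 0#
    product-≢0 []       []         = 1≢0
    product-≢0 (x ∷ xs) (x≢0 ∷ ne) = *-≢0 x≢0 (product-≢0 xs ne)

    product-map-* : ∀ a xs → Product.fold (map (a *_) xs) ≡ a ^ length xs * Product.fold xs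
    product-map-* a []       = sym (*-identityˡ 1#)
    product-map-* a (x ∷ xs) = trans (cong ((a * x) *_) (product-map-* a xs))
      (solve 4 (λ a x b c → (a :* x) :* (b :* c) := (a :* b) :* (x :* c)) refl a x (a ^ length xs) (Product.fold xs))

  -- Multiplication by a permutes the units, so it does not change their product.
  ^-length-units : ∀ a → a ≢ 0# → a ^ length units ≡ 1#
  ^-length-units a a≢0 = *-cancelˡ (Product.fold units) (product-≢0 units units-≢0) (begin
    Π * a ^ length units                ≡⟨ *-comm _ _ ⟩
    a ^ length units * Π                ≡⟨ product-map-* a units ⟨
    Product.fold (map (a *_) units)     ≡⟨ Product.fold-sameElements (map (a *_) units) units
                                             (map⁺ (*-cancelˡ a a≢0) units-unique) units-unique ⊆ ⊇ ⟩
    Π                                   ≡⟨ *-identityʳ _ ⟨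
    Π * 1#                              ∎)
    where
    Π = Product.fold units
    ⊆ : ∀ z → z ∈ map (a *_) units → z ∈ units
    ⊆ z z∈ with ∈-map⁻ (a *_) z∈
    ... | x , x∈ , refl = ∈-units (*-≢0 a≢0 (∈-units⇒≢0 x∈))
    ⊇ : ∀ z → z ∈ units → z ∈ map (a *_) units
    ⊇ z z∈ = subst (_∈ map (a *_) units) (inv-cancelˡ a z a≢0)
               (∈-map⁺ (a *_) (∈-units (*-≢0 (inv-≢0 a a≢0) (∈-units⇒≢0 z∈))))

  x^q≡x : ∀ x → x ^ q ≡ x
  x^q≡x x with x ≟ 0#
  ... | yes refl = trans (cong (0# ^_) (sym suc-length-units)) (zeroˡ _)
  ... | no x≢0 = begin
    x ^ q                     ≡⟨ cong (x ^_) suc-length-units ⟨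
    x * x ^ length units      ≡⟨ cong (x *_) (^-length-units x x≢0) ⟩
    x * 1#                    ≡⟨ *-identityʳ x ⟩
    x                         ∎

module Polynomials (𝔽 : FiniteField) where
  open ≡ using (refl; sym; trans; cong; cong₂; subst)
  open ≡.≡-Reasoning
  open FieldProperties 𝔽

  -- Coefficient lists, constant coefficient first.
  eval : List F → F → F
  eval []       x = 0#
  eval (c ∷ cs) x = c + x * eval cs x

  IsZero : List F → Set
  IsZero = All (_≡ 0#)

  eval-IsZero : ∀ cs x → IsZero cs → eval cs x ≡ 0#
  eval-IsZero []       x []          = refl
  eval-IsZero (c ∷ cs) x (refl ∷ cs≡0) =
    trans (cong (λ t → 0# + x * t) (eval-IsZero cs x cs≡0)) (trans (+-identityˡ _) (zeroʳ x))

  eval-constant : ∀ c cs x → IsZero cs → eval (c ∷ cs) x ≡ c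
  eval-constant c cs x cs≡0 = trans (cong (λ t → c + x * t) (eval-IsZero cs x cs≡0)) (trans (cong (c +_) (zeroʳ x)) (+-identityʳ c))

  -- For every c, quotient cs r is the quotient of c ∷ cs by X - r (synthetic division).
  quotient : List F → F → List F
  quotient []       r = []
  quotient (d ∷ ds) r = eval (d ∷ ds) r ∷ quotient ds r

  length-quotient : ∀ cs r → length (quotient cs r) ≡ length cs
  length-quotient []       r = refl
  length-quotient (d ∷ ds) r = cong suc (length-quotient ds r)

  eval-division : ∀ c cs r x → eval (c ∷ cs) x ≡ eval (c ∷ cs) r + (x - r) * eval (quotient cs r) x
  eval-division c []       r x = solve 3 (λ c r x → c :+ x :* :0 := (c :+ r :* :0) :+ (x :- r) :* :0) refl c r x
  eval-division c (d ∷ ds) r x = begin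
    c + x * eval (d ∷ ds) x        ≡⟨ cong (λ t → c + x * t) (eval-division d ds r x) ⟩
    c + x * (e + (x - r) * q′)     ≡⟨ solve 5 (λ c x e r q → c :+ x :* (e :+ (x :- r) :* q) := (c :+ r :* e) :+ (x :- r) :* (e :+ x :* q)) refl c x e r q′ ⟩
    (c + r * e) + (x - r) * (e + x * q′) ∎
    where
    e  = eval (d ∷ ds) r
    q′ = eval (quotient ds r) x

  quotient-IsZero : ∀ cs r → IsZero (quotient cs r) → IsZero cs
  quotient-IsZero []       r []            = []
  quotient-IsZero (d ∷ ds) r (d+r·ds≡0 ∷ qs≡0) = d≡0 ∷ ds≡0
    where
    ds≡0 = quotient-IsZero ds r qs≡0
    d≡0 = trans (sym (eval-constant d ds r ds≡0)) d+r·ds≡0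

  roots⇒IsZero : ∀ cs rs → Unique rs → length cs ℕ.≤ length rs → All (λ r → eval cs r ≡ 0#) rs → IsZero cs
  roots⇒IsZero []       rs       _          _          _               = []
  roots⇒IsZero (c ∷ cs) (r ∷ rs) (r∉ ∷ urs) (ℕ.s≤s le) (cr≡0 ∷ crs≡0) = c≡0 ∷ cs≡0
    where
    quotient-roots : ∀ {x} → r ≢ x × eval (c ∷ cs) x ≡ 0# → eval (quotient cs r) x ≡ 0#
    quotient-roots {x} (r≢x , cx≡0) with zero-divisor (x - r) _ (begin
      (x - r) * eval (quotient cs r) x                      ≡⟨ +-identityˡ _ ⟨
      0# + (x - r) * eval (quotient cs r) x                  ≡⟨ cong (_+ (x - r) * eval (quotient cs r) x) cr≡0 ⟨
      eval (c ∷ cs) r + (x - r) * eval (quotient cs r) x     ≡⟨ eval-division c cs r x ⟨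
      eval (c ∷ cs) x                                        ≡⟨ cx≡0 ⟩
      0#                                                     ∎)
    ... | inj₁ x-r≡0 = ⊥-elim (r≢x (sym (x-y≡0⇒x≡y x r x-r≡0)))
    ... | inj₂ q≡0   = q≡0
    cs≡0 = quotient-IsZero cs r (roots⇒IsZero (quotient cs r) rs urs
             (subst (ℕ._≤ length rs) (sym (length-quotient cs r)) le)
             (All.zipWith quotient-roots (r∉ , crs≡0)))
    c≡0 = trans (sym (eval-constant c cs r cs≡0)) cr≡0

  X^ : ℕ → List F
  X^ zero    = 1# ∷ []
  X^ (suc k) = 0# ∷ X^ k

  eval-X^ : ∀ k w → eval (X^ k) w ≡ w ^ k
  eval-X^ zero    w = trans (cong (1# +_) (zeroʳ w)) (+-identityʳ 1#)
  eval-X^ (suc k) w = trans (+-identityˡ _) (cong (w *_) (eval-X^ k w))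

  length-X^ : ∀ k → length (X^ k) ≡ suc k
  length-X^ zero    = refl
  length-X^ (suc k) = cong suc (length-X^ k)

  X^-≢0 : ∀ k → ¬ IsZero (X^ k)
  X^-≢0 zero    (1≡0 ∷ _) = 1≢0 1≡0
  X^-≢0 (suc k) (_ ∷ z)   = X^-≢0 k z

  infixl 6 _⊕_
  _⊕_ : List F → List F → List F
  []       ⊕ bs       = bs
  (a ∷ as) ⊕ []       = a ∷ as
  (a ∷ as) ⊕ (b ∷ bs) = (a + b) ∷ (as ⊕ bs)

  eval-⊕ : ∀ as bs w → eval (as ⊕ bs) w ≡ eval as w + eval bs w
  eval-⊕ []       bs       w = sym (+-identityˡ _)
  eval-⊕ (a ∷ as) []       w = sym (+-identityʳ _)
  eval-⊕ (a ∷ as) (b ∷ bs) w = begin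
    (a + b) + w * eval (as ⊕ bs) w              ≡⟨ cong (λ t → (a + b) + w * t) (eval-⊕ as bs w) ⟩
    (a + b) + w * (eval as w + eval bs w)       ≡⟨ solve 5 (λ a b w u v → (a :+ b) :+ w :* (u :+ v) := (a :+ w :* u) :+ (b :+ w :* v)) refl a b w _ _ ⟩
    (a + w * eval as w) + (b + w * eval bs w)   ∎

  length-⊕ : ∀ as bs → length bs ℕ.≤ length as → length (as ⊕ bs) ≡ length as
  length-⊕ []       []       _          = refl
  length-⊕ (a ∷ as) []       _          = refl
  length-⊕ (a ∷ as) (b ∷ bs) (ℕ.s≤s le) = cong suc (length-⊕ as bs le)

  X^⊕-≢0 : ∀ k bs → length bs ℕ.≤ k → ¬ IsZero (X^ k ⊕ bs)
  X^⊕-≢0 zero    []       _          (1≡0 ∷ _) = 1≢0 1≡0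
  X^⊕-≢0 (suc k) []       _          (_ ∷ z)   = X^-≢0 k z
  X^⊕-≢0 (suc k) (b ∷ bs) (ℕ.s≤s le) (_ ∷ z)   = X^⊕-≢0 k bs le z

module Trace (𝔽 : FiniteField) where
  open ≡ using (refl; sym; trans; cong; cong₂; subst)
  open ≡.≡-Reasoning
  open FieldProperties 𝔽
  open PrimeSubfield 𝔽
  open Polynomials 𝔽
  open Units 𝔽 using (x^q≡x)

  private
    Trᵢ : F → ℕ → F
    Trᵢ = partialTrace 𝔽

  Trᵢ-+ : ∀ a b i → Trᵢ (a + b) i ≡ Trᵢ a i + Trᵢ b i
  Trᵢ-+ a b zero    = sym (+-identityˡ 0#)
  Trᵢ-+ a b (suc i) = begin
    (a + b) ^ (p ℕ.^ i) + Trᵢ (a + b) i                        ≡⟨ cong₂ _+_ (frobenius^-+ i a b) (Trᵢ-+ a b i) ⟩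
    (a ^ (p ℕ.^ i) + b ^ (p ℕ.^ i)) + (Trᵢ a i + Trᵢ b i)      ≡⟨ solve 4 (λ u v w z → (u :+ v) :+ (w :+ z) := (u :+ w) :+ (v :+ z)) refl _ _ _ _ ⟩
    (a ^ (p ℕ.^ i) + Trᵢ a i) + (b ^ (p ℕ.^ i) + Trᵢ b i)      ∎

  Tr-+ : ∀ a b → Tr (a + b) ≡ Tr a + Tr b
  Tr-+ a b = begin
    Tr (a + b)           ≡⟨ partialTrace-n 𝔽 (a + b) ⟨
    Trᵢ (a + b) n        ≡⟨ Trᵢ-+ a b n ⟩
    Trᵢ a n + Trᵢ b n    ≡⟨ cong₂ _+_ (partialTrace-n 𝔽 a) (partialTrace-n 𝔽 b) ⟩
    Tr a + Tr b          ∎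

  Tr-0 : Tr 0# ≡ 0#
  Tr-0 = x+y≡x⇒y≡0 (Tr 0#) (Tr 0#) (trans (sym (Tr-+ 0# 0#)) (cong Tr (+-identityˡ 0#)))

  Trᵢ-^p : ∀ x i → Trᵢ x i ^ p + x ≡ x ^ (p ℕ.^ i) + Trᵢ x i
  Trᵢ-^p x zero = trans (cong (_+ x) 0^p≡0) (trans (+-identityˡ x) (sym (trans (+-identityʳ _) (*-identityʳ x))))
  Trᵢ-^p x (suc i) = begin
    (x ^ (p ℕ.^ i) + Trᵢ x i) ^ p + x              ≡⟨ cong (_+ x) (frobenius-+ _ _) ⟩
    ((x ^ (p ℕ.^ i)) ^ p + Trᵢ x i ^ p) + x        ≡⟨ +-assoc _ _ _ ⟩
    (x ^ (p ℕ.^ i)) ^ p + (Trᵢ x i ^ p + x)        ≡⟨ cong₂ _+_ x^p^i^p≡x^p^[1+i] (Trᵢ-^p x i) ⟩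
    x ^ (p ℕ.* p ℕ.^ i) + (x ^ (p ℕ.^ i) + Trᵢ x i) ∎
    where
    x^p^i^p≡x^p^[1+i] : (x ^ (p ℕ.^ i)) ^ p ≡ x ^ (p ℕ.* p ℕ.^ i)
    x^p^i^p≡x^p^[1+i] = sym (trans (cong (x ^_) (ℕ.*-comm p (p ℕ.^ i))) (^-* x (p ℕ.^ i) p))

  -- Tr x ^ p + x = x ^ q + Tr x, and x ^ q = x.
  Tr-^p : ∀ x → Tr x ^ p ≡ Tr x
  Tr-^p x = begin
    Tr x ^ p                            ≡⟨ solve 2 (λ a x → a := (a :+ x) :- x) refl _ x ⟩
    (Tr x ^ p + x) - x                  ≡⟨ cong (λ t → (t ^ p + x) - x) (partialTrace-n 𝔽 x) ⟨
    (Trᵢ x n ^ p + x) - x               ≡⟨ cong (_- x) (Trᵢ-^p x n) ⟩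
    (x ^ (p ℕ.^ n) + Trᵢ x n) - x       ≡⟨ cong (λ t → (x ^ t + Trᵢ x n) - x) card ⟨
    (x ^ q + Trᵢ x n) - x               ≡⟨ cong (λ t → (t + Trᵢ x n) - x) (x^q≡x x) ⟩
    (x + Trᵢ x n) - x                   ≡⟨ solve 2 (λ x a → (x :+ a) :- x := a) refl x _ ⟩
    Trᵢ x n                             ≡⟨ partialTrace-n 𝔽 x ⟩
    Tr x                                ∎

  -- X ^ p - X has the p roots ⟨ 0 ⟩ … ⟨ p - 1 ⟩, so no other root.
  x^p≡x⇒primeField : ∀ z → z ^ p ≡ z → Σ ℕ λ k → k ℕ.< p × z ≡ ⟨ k ⟩
  x^p≡x⇒primeField z z^p≡z with any? (z ≟_) (applyUpTo ⟨_⟩ p)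
  ... | yes z∈ = ∈-applyUpTo⁻ ⟨_⟩ z∈
  ... | no z∉ = ⊥-elim (X^-≢0 r (drop₂ (roots⇒IsZero X^p-X (z ∷ applyUpTo ⟨_⟩ p) distinct length-≤ all-roots)))
    where
    r = p ℕ.∸ 2
    2+r≡p : 2 ℕ.+ r ≡ p
    2+r≡p = ℕ.m+[n∸m]≡n 1<p
    X^p-X : List F
    X^p-X = 0# ∷ (- 1#) ∷ X^ r
    drop₂ : IsZero X^p-X → IsZero (X^ r)
    drop₂ (_ ∷ _ ∷ z) = z
    eval-X^p-X : ∀ w → eval X^p-X w ≡ (w ^ p) - w
    eval-X^p-X w = begin
      0# + w * ((- 1#) + w * eval (X^ r) w) ≡⟨ cong (λ t → 0# + w * ((- 1#) + w * t)) (eval-X^ r w) ⟩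
      0# + w * ((- 1#) + w * w ^ r)         ≡⟨ solve 2 (λ w a → :0 :+ w :* (:- :1 :+ w :* a) := w :* (w :* a) :- w) refl w (w ^ r) ⟩
      (w * (w * w ^ r)) - w                 ≡⟨ cong (λ t → (w ^ t) - w) 2+r≡p ⟩
      (w ^ p) - w                           ∎
    distinct : Unique (z ∷ applyUpTo ⟨_⟩ p)
    distinct = ¬Any⇒All¬ _ z∉ ∷ applyUpTo⁺₁ ⟨_⟩ p ⟨⟩-<-distinct
    length-≤ : length X^p-X ℕ.≤ length (z ∷ applyUpTo ⟨_⟩ p)
    length-≤ = ℕ.≤-reflexive (trans (cong (λ t → suc (suc t)) (length-X^ r))
                 (cong suc (trans 2+r≡p (sym (length-applyUpTo ⟨_⟩ p)))))
    root : ∀ w → w ^ p ≡ w → eval X^p-X w ≡ 0#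
    root w w^p≡w = trans (eval-X^p-X w) (trans (cong (_- w) w^p≡w) (-‿inverseʳ w))
    all-roots : All (λ w → eval X^p-X w ≡ 0#) (z ∷ applyUpTo ⟨_⟩ p)
    all-roots = root z z^p≡z ∷ All.tabulate λ {w} w∈ →
      let (k , _ , w≡⟨k⟩) = ∈-applyUpTo⁻ ⟨_⟩ w∈ in root w (subst (λ t → t ^ p ≡ t) (sym w≡⟨k⟩) (⟨⟩^p≡⟨⟩ k))

  private
    TrPoly : ℕ → List F
    TrPoly zero    = []
    TrPoly (suc i) = X^ (p ℕ.^ i) ⊕ TrPoly i

    eval-TrPoly : ∀ i w → eval (TrPoly i) w ≡ Trᵢ w i
    eval-TrPoly zero    w = refl
    eval-TrPoly (suc i) w = trans (eval-⊕ (X^ (p ℕ.^ i)) (TrPoly i) w) (cong₂ _+_ (eval-X^ (p ℕ.^ i) w) (eval-TrPoly i w))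

    1≤p^i : ∀ i → 1 ℕ.≤ p ℕ.^ i
    1≤p^i zero    = ℕ.s≤s ℕ.z≤n
    1≤p^i (suc i) = ℕ.*-mono-≤ (ℕ.<⇒≤ 1<p) (1≤p^i i)

    length-TrPoly : ∀ i → length (TrPoly i) ℕ.≤ p ℕ.^ i
    length-TrPoly zero    = ℕ.z≤n
    length-TrPoly (suc i) = subst (ℕ._≤ p ℕ.* p ℕ.^ i) (sym (trans (length-⊕ (X^ (p ℕ.^ i)) (TrPoly i) shorter) (length-X^ _)))
      (ℕ.≤-trans (ℕ.+-monoˡ-≤ (p ℕ.^ i) (1≤p^i i))
      (ℕ.≤-trans (ℕ.+-monoʳ-≤ (p ℕ.^ i) (ℕ.m≤m+n (p ℕ.^ i) 0))
                 (ℕ.*-monoˡ-≤ (p ℕ.^ i) 1<p)))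
      where
      shorter : length (TrPoly i) ℕ.≤ length (X^ (p ℕ.^ i))
      shorter = ℕ.≤-trans (length-TrPoly i) (ℕ.≤-trans (ℕ.n≤1+n _) (ℕ.≤-reflexive (sym (length-X^ _))))

    n≡suc : Σ ℕ λ m → n ≡ suc m
    n≡suc with n | card
    ... | suc m | _ = m , refl
    ... | zero  | q≡1 = ⊥-elim (0≢1 (singleton q≡1))
      where
      singleton : length elems ≡ 1 → 0# ≡ 1#
      singleton _ with elems | complete 0# | complete 1#
      ... | _ ∷ [] | here 0≡x | here 1≡x = trans 0≡x (sym 1≡x)

  -- Tr is a polynomial of degree p ^ (n - 1) < q, so it cannot vanish on all of F.
  Tr-nontrivial : Σ F λ x → Tr x ≢ 0#
  Tr-nontrivial with any? (λ x → ¬? (Tr x ≟ 0#)) elems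
  ... | yes Tr≢0 = Any.satisfied Tr≢0
  ... | no Tr≡0 = ⊥-elim (X^⊕-≢0 (p ℕ.^ m) (TrPoly m) (length-TrPoly m)
                    (roots⇒IsZero (TrPoly (suc m)) elems unique length-≤ all-roots))
    where
    m = proj₁ n≡suc
    all-roots : All (λ w → eval (TrPoly (suc m)) w ≡ 0#) elems
    all-roots = All.map (λ {w} ¬Tr≢0 → begin
        eval (TrPoly (suc m)) w     ≡⟨ eval-TrPoly (suc m) w ⟩
        Trᵢ w (suc m)               ≡⟨ cong (Trᵢ w) (proj₂ n≡suc) ⟨
        Trᵢ w n                     ≡⟨ partialTrace-n 𝔽 w ⟩
        Tr w                        ≡⟨ decidable-stable (Tr w ≟ 0#) ¬Tr≢0 ⟩
        0#                          ∎)
      (¬Any⇒All¬ elems Tr≡0)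
    length-≤ : length (TrPoly (suc m)) ℕ.≤ length elems
    length-≤ = ℕ.≤-trans (length-TrPoly (suc m)) (ℕ.≤-reflexive (trans (cong (p ℕ.^_) (sym (proj₂ n≡suc))) (sym card)))

  private
    ∸-suc-< : ∀ a b → 0 ℕ.< a → a ℕ.∸ suc b ℕ.< a
    ∸-suc-< (suc a) b _ = ℕ.s≤s (ℕ.m∸n≤m a b)

    ∸-suc-≤-step : ∀ a b {k} → a ℕ.∸ suc b ℕ.≤ k → k ≢ a ℕ.∸ suc b → a ℕ.∸ b ℕ.≤ k
    ∸-suc-≤-step zero    b {k} _  _  = subst (ℕ._≤ k) (sym (ℕ.0∸n≡0 b)) ℕ.z≤n
    ∸-suc-≤-step (suc a) zero    le  ne = ℕ.≤∧≢⇒< le (λ e → ne (sym e))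
    ∸-suc-≤-step (suc a) (suc b) le  ne = ∸-suc-≤-step a b le ne

    search-correct : ∀ x m k → k ℕ.< p → p ℕ.∸ m ℕ.≤ k → Tr x ≡ ⟨ k ⟩ →
                     Tr x ≡ ⟨ traceSearch 𝔽 x m ⟩ × traceSearch 𝔽 x m ℕ.< p
    search-correct x zero    k k<p p≤k _ = ⊥-elim (ℕ.<⇒≱ k<p p≤k)
    search-correct x (suc m) k k<p p-m-1≤k Trx≡⟨k⟩ with Tr x ≟ ⟨ p ℕ.∸ suc m ⟩
    ... | yes Trx≡ = Trx≡ , ∸-suc-< p m (ℕ.<-trans (ℕ.s≤s ℕ.z≤n) 1<p)
    ... | no Trx≢  = search-correct x m k k<p (∸-suc-≤-step p m p-m-1≤k (λ k≡ → Trx≢ (trans Trx≡⟨k⟩ (cong ⟨_⟩ k≡))))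
                       Trx≡⟨k⟩

  trℕ-correct : ∀ x → Tr x ≡ ⟨ trℕ x ⟩ × trℕ x ℕ.< p
  trℕ-correct x with x^p≡x⇒primeField (Tr x) (Tr-^p x)
  ... | k , k<p , Trx≡⟨k⟩ = subst (λ t → Tr x ≡ ⟨ t ⟩ × t ℕ.< p) (traceSearch-p 𝔽 x)
                             (search-correct x p k k<p (subst (ℕ._≤ k) (sym (ℕ.n∸n≡0 p)) ℕ.z≤n) Trx≡⟨k⟩)

  trℕ-+ : ∀ a b → trℕ (a + b) % p ≡ (trℕ a ℕ.+ trℕ b) % p
  trℕ-+ a b = ⟨⟩-≡⇒%-≡ _ _ (begin
    ⟨ trℕ (a + b) ⟩               ≡⟨ proj₁ (trℕ-correct (a + b)) ⟨
    Tr (a + b)                    ≡⟨ Tr-+ a b ⟩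
    Tr a + Tr b                   ≡⟨ cong₂ _+_ (proj₁ (trℕ-correct a)) (proj₁ (trℕ-correct b)) ⟩
    ⟨ trℕ a ⟩ + ⟨ trℕ b ⟩         ≡⟨ ⟨⟩-+ (trℕ a) (trℕ b) ⟨
    ⟨ trℕ a ℕ.+ trℕ b ⟩           ∎)

  trℕ-0 : trℕ 0# ≡ 0
  trℕ-0 = ⟨⟩-injective _ _ (proj₂ (trℕ-correct 0#)) (ℕ.<-trans (ℕ.s≤s ℕ.z≤n) 1<p)
            (trans (sym (proj₁ (trℕ-correct 0#))) Tr-0)

  trℕ-nontrivial : Σ F λ x → 0 ℕ.< trℕ x × trℕ x ℕ.< p
  trℕ-nontrivial with Tr-nontrivial
  ... | x , Trx≢0 = x , 0<trℕx , proj₂ (trℕ-correct x)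
    where
    0<trℕx : 0 ℕ.< trℕ x
    0<trℕx with trℕ x | trℕ-correct x
    ... | zero  | Trx≡0 , _ = ⊥-elim (Trx≢0 Trx≡0)
    ... | suc _ | _         = ℕ.s≤s ℕ.z≤n

module CommutativeRingLemmas {c ℓ : Level} (K : CommutativeRing c ℓ) where
  open CommutativeRing K
  open IntegerCoefficientSolver K
  open import Relation.Binary.Reasoning.Setoid setoid

  -- Q² = s⁴ has inverse (s⁻¹)⁴ = -(s⁻¹) · (-1)³ (s⁻¹)³.
  divide-by-square : ∀ {a b h z s s⁻¹ Q} → a * (b * h) ≈ Q * (Q * z) → s * s ≈ Q → s * s⁻¹ ≈ 1# →
                     z ≈ ((- (a * b)) * s⁻¹) * (natPow 1# _*_ (- 1#) 3 * (natPow 1# _*_ s⁻¹ 3 * h))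
  divide-by-square {a} {b} {h} {z} {s} {s⁻¹} {Q} abh≈QQz s²≈Q ss⁻¹≈1 = sym (begin
    ((- (a * b)) * s⁻¹) * (natPow 1# _*_ (- 1#) 3 * (natPow 1# _*_ s⁻¹ 3 * h))
      ≈⟨ solve 4 (λ a b i h → ((:- (a :* b)) :* i) :* ((:- :1) :* ((:- :1) :* ((:- :1) :* :1)) :* (i :* (i :* (i :* :1)) :* h))
                            := (i :* i :* i :* i) :* (a :* (b :* h))) refl a b s⁻¹ h ⟩
    (s⁻¹ * s⁻¹ * s⁻¹ * s⁻¹) * (a * (b * h))                ≈⟨ *-congˡ abh≈QQz ⟩
    (s⁻¹ * s⁻¹ * s⁻¹ * s⁻¹) * (Q * (Q * z))                ≈⟨ *-congˡ (*-cong (sym s²≈Q) (*-congʳ (sym s²≈Q))) ⟩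
    (s⁻¹ * s⁻¹ * s⁻¹ * s⁻¹) * ((s * s) * ((s * s) * z))    ≈⟨ solve 3 (λ i s z → (i :* i :* i :* i) :* ((s :* s) :* ((s :* s) :* z)) := (s :* i) :* (s :* i) :* (s :* i) :* (s :* i) :* z) refl s⁻¹ s z ⟩
    (s * s⁻¹) * (s * s⁻¹) * (s * s⁻¹) * (s * s⁻¹) * z      ≈⟨ *-congʳ (*-cong (*-cong (*-cong ss⁻¹≈1 ss⁻¹≈1) ss⁻¹≈1) ss⁻¹≈1) ⟩
    1# * 1# * 1# * 1# * z                                  ≈⟨ solve 1 (λ z → :1 :* :1 :* :1 :* :1 :* z := z) refl z ⟩
    z                                                      ∎)

  fixed-by-≉1⇒≈0 : (∀ x → ¬ (x ≈ 0#) → Σ Carrier λ y → x * y ≈ 1#) →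
                   ∀ {t s} → ¬ (t ≈ 1#) → s ≈ t * s → s ≈ 0#
  fixed-by-≉1⇒≈0 invertible {t} {s} t≉1 s≈ts with invertible (1# - t) 1-t≉0
    where
    1-t≉0 : ¬ (1# - t ≈ 0#)
    1-t≉0 1-t≈0 = t≉1 (begin
      t                             ≈⟨ solve 2 (λ t a → t := (t :+ a) :- a) refl t (1# - t) ⟩
      (t + (1# - t)) - (1# - t)     ≈⟨ +-cong (solve 1 (λ t → t :+ (:1 :- t) := :1) refl t) (-‿cong 1-t≈0) ⟩
      1# - 0#                       ≈⟨ solve 0 (:1 :- :0 := :1) refl ⟩
      1#                            ∎)
  ... | u , [1-t]u≈1 = begin
    s                    ≈⟨ *-identityˡ s ⟨
    1# * s               ≈⟨ *-congʳ [1-t]u≈1 ⟨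
    ((1# - t) * u) * s   ≈⟨ solve 4 (λ t u s ts → ((:1 :- t) :* u) :* s := u :* (s :- t :* s)) refl t u s (t * s) ⟩
    u * (s - t * s)      ≈⟨ *-congˡ (+-congˡ (-‿cong s≈ts)) ⟨
    u * (s - s)          ≈⟨ solve 2 (λ u s → u :* (s :- s) := :0) refl u s ⟩
    0#                   ∎

module ListSums {c ℓ : Level} (K : CommutativeRing c ℓ) where
  open CommutativeRing K
  open import Relation.Binary.Reasoning.Setoid setoid
  open IntegerCoefficientSolver K

  -- Definitionally CharSums.Σ[_]_, so these lemmas apply to the sums in the statement.
  ∑ : {A : Set} → List A → (A → Carrier) → Carrier
  ∑ xs f = foldr (λ a s → f a + s) 0# xs

  module _ {A : Set} where

    ∑-cong∈ : (xs : List A) {f g : A → Carrier} → (∀ a → a ∈ xs → f a ≈ g a) → ∑ xs f ≈ ∑ xs g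
    ∑-cong∈ []       f≈g = refl
    ∑-cong∈ (x ∷ xs) f≈g = +-cong (f≈g x (here ≡.refl)) (∑-cong∈ xs (λ a a∈ → f≈g a (there a∈)))

    ∑-cong : (xs : List A) {f g : A → Carrier} → (∀ a → f a ≈ g a) → ∑ xs f ≈ ∑ xs g
    ∑-cong xs f≈g = ∑-cong∈ xs (λ a _ → f≈g a)

    ∑-zero : (xs : List A) {f : A → Carrier} → (∀ a → f a ≈ 0#) → ∑ xs f ≈ 0#
    ∑-zero []       f≈0 = refl
    ∑-zero (x ∷ xs) f≈0 = trans (+-cong (f≈0 x) (∑-zero xs f≈0)) (+-identityˡ 0#)

    ∑-distrib-+ : (xs : List A) (f g : A → Carrier) → ∑ xs (λ a → f a + g a) ≈ ∑ xs f + ∑ xs g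
    ∑-distrib-+ []       f g = sym (+-identityˡ 0#)
    ∑-distrib-+ (x ∷ xs) f g = trans (+-congˡ (∑-distrib-+ xs f g))
      (solve 4 (λ a b c d → (a :+ b) :+ (c :+ d) := (a :+ c) :+ (b :+ d)) refl _ _ _ _)

    ∑-*ˡ : (xs : List A) (k : Carrier) (f : A → Carrier) → ∑ xs (λ a → k * f a) ≈ k * ∑ xs f
    ∑-*ˡ []       k f = sym (zeroʳ k)
    ∑-*ˡ (x ∷ xs) k f = trans (+-congˡ (∑-*ˡ xs k f)) (sym (distribˡ k _ _))

    ∑-*ʳ : (xs : List A) (k : Carrier) (f : A → Carrier) → ∑ xs (λ a → f a * k) ≈ ∑ xs f * k
    ∑-*ʳ xs k f = trans (∑-cong xs (λ a → *-comm (f a) k)) (trans (∑-*ˡ xs k f) (*-comm k _))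

    ∑-const-1 : (xs : List A) → ∑ xs (λ _ → 1#) ≈ natMul 0# _+_ (length xs) 1#
    ∑-const-1 []       = refl
    ∑-const-1 (x ∷ xs) = +-congˡ (∑-const-1 xs)

    ∑-filter : {P : Pred A Level.zero} (P? : Decidable P) (xs : List A) (f : A → Carrier) →
               ∑ (filter P? xs) f ≈ ∑ xs (λ a → if does (P? a) then f a else 0#)
    ∑-filter P? []       f = refl
    ∑-filter P? (x ∷ xs) f with does (P? x)
    ... | true  = +-congˡ (∑-filter P? xs f)
    ... | false = trans (∑-filter P? xs f) (sym (+-identityˡ _))

    ∑-map : {B : Set} (σ : A → B) (xs : List A) (f : B → Carrier) → ∑ (map σ xs) f ≈ ∑ xs (λ a → f (σ a))
    ∑-map σ []       f = refl
    ∑-map σ (x ∷ xs) f = +-congˡ (∑-map σ xs f)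

    ∑-bijection : (xs : List A) → Unique xs → (∀ x → x ∈ xs) →
                  (σ ρ : A → A) → (∀ x → σ (ρ x) ≡ x) → (∀ x → ρ (σ x) ≡ x) →
                  (f : A → Carrier) → ∑ xs (λ x → f (σ x)) ≈ ∑ xs f
    ∑-bijection xs xs-unique xs-complete σ ρ σρ ρσ f = trans (sym (∑-map σ xs f))
      (fold-sameElements (map σ xs) xs (map⁺ σ-injective xs-unique) xs-unique (λ z _ → xs-complete z) ⊇)
      where
      open FoldOverUniqueLists +-commutativeMonoid f
      σ-injective : ∀ {x y} → σ x ≡ σ y → x ≡ y
      σ-injective {x} {y} σx≡σy = ≡.trans (≡.sym (ρσ x)) (≡.trans (≡.cong ρ σx≡σy) (ρσ y))
      ⊇ : ∀ z → z ∈ xs → z ∈ map σ xs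
      ⊇ z _ = ≡.subst (_∈ map σ xs) (σρ z) (∈-map⁺ σ (xs-complete (ρ z)))

  ∑-comm : {A B : Set} (xs : List A) (ys : List B) (f : A → B → Carrier) →
           ∑ xs (λ a → ∑ ys (λ b → f a b)) ≈ ∑ ys (λ b → ∑ xs (λ a → f a b))
  ∑-comm []       ys f = sym (∑-zero ys (λ _ → refl))
  ∑-comm (x ∷ xs) ys f = trans (+-congˡ (∑-comm xs ys f)) (sym (∑-distrib-+ ys (f x) (λ b → ∑ xs (λ a → f a b))))

module CharacterSumProperties {c ℓ : Level} (𝔽 : FiniteField) (K : CommutativeRing c ℓ) where
  open FiniteField 𝔽 renaming (_+_ to _+F_; _*_ to _*F_; -_ to -F_; 0# to 0F; 1# to 1F; _-_ to _-F_)
  open CommutativeRing K renaming (Carrier to 𝕂)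
  open CharSums 𝔽 K
  open ListSums K
  open CommutativeRingLemmas K using (fixed-by-≉1⇒≈0)
  open IntegerCoefficientSolver K
  open import Relation.Binary.Reasoning.Setoid setoid
  module FP = FieldProperties 𝔽
  open PrimeSubfield 𝔽 using (p-nonZero)
  open Units 𝔽 using (≢0?; ∈-units⇒≢0) public
  open Trace 𝔽 using (trℕ-+; trℕ-0; trℕ-nontrivial)

  [≡]-yes : ∀ {a b} → a ≡ b → [ a ≡F b ] ≈ 1#
  [≡]-yes {a} {b} a≡b with a ≟ b
  ... | yes _   = refl
  ... | no a≢b  = ⊥-elim (a≢b a≡b)

  [≡]-no : ∀ {a b} → a ≢ b → [ a ≡F b ] ≈ 0#
  [≡]-no {a} {b} a≢b with a ≟ b
  ... | yes a≡b = ⊥-elim (a≢b a≡b)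
  ... | no _    = refl

  [≡]-cong : ∀ {a b x y} → (a ≡ b → x ≡ y) → (x ≡ y → a ≡ b) → [ a ≡F b ] ≈ [ x ≡F y ]
  [≡]-cong {a} {b} ⇒ ⇐ with a ≟ b
  ... | yes a≡b = sym ([≡]-yes (⇒ a≡b))
  ... | no a≢b  = sym ([≡]-no (λ x≡y → a≢b (⇐ x≡y)))

  ∑-[≡] : (a : F) (g : F → 𝕂) → Σ[ elems ] (λ x → [ x ≡F a ] * g x) ≈ g a
  ∑-[≡] a g = go elems unique (complete a)
    where
    go : (xs : List F) → Unique xs → a ∈ xs → Σ[ xs ] (λ x → [ x ≡F a ] * g x) ≈ g a
    go (x ∷ xs) (x∉ ∷ _) (here ≡.refl) = begin
      [ a ≡F a ] * g a + Σ[ xs ] (λ x → [ x ≡F a ] * g x)   ≈⟨ +-cong (*-congʳ ([≡]-yes ≡.refl)) rest≈0 ⟩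
      1# * g a + 0#                                         ≈⟨ +-identityʳ _ ⟩
      1# * g a                                              ≈⟨ *-identityˡ _ ⟩
      g a                                                   ∎
      where
      rest≈0 = trans (∑-cong∈ xs (λ y y∈ → trans (*-congʳ ([≡]-no (λ y≡a → All.lookup x∉ y∈ (≡.sym y≡a)))) (zeroˡ _)))
                     (∑-zero xs (λ _ → refl))
    go (x ∷ xs) (x∉ ∷ u) (there a∈) = begin
      [ x ≡F a ] * g x + Σ[ xs ] (λ x → [ x ≡F a ] * g x)   ≈⟨ +-cong (*-congʳ ([≡]-no (λ x≡a → All.lookup x∉ a∈ x≡a))) (go xs u a∈) ⟩
      0# * g x + g a                                        ≈⟨ +-congʳ (zeroˡ _) ⟩
      0# + g a                                              ≈⟨ +-identityˡ _ ⟩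
      g a                                                   ∎

  whenNonzero : F → 𝕂 → 𝕂
  whenNonzero x v = if does (≢0? x) then v else 0#

  whenNonzero-0 : ∀ v → whenNonzero 0F v ≈ 0#
  whenNonzero-0 v with 0F ≟ 0F
  ... | yes _   = refl
  ... | no 0≢0  = ⊥-elim (0≢0 ≡.refl)

  whenNonzero-≢0 : ∀ {x} v → x ≢ 0F → whenNonzero x v ≈ v
  whenNonzero-≢0 {x} v x≢0 with x ≟ 0F
  ... | yes x≡0 = ⊥-elim (x≢0 x≡0)
  ... | no _    = refl

  ∑-units : (f : F → 𝕂) → Σ[ units ] f ≈ Σ[ elems ] (λ x → whenNonzero x (f x))
  ∑-units = ∑-filter ≢0? elems

  ∑-units≈∑-elems : (f : F → 𝕂) → f 0F ≈ 0# → Σ[ units ] f ≈ Σ[ elems ] f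
  ∑-units≈∑-elems f f0≈0 = trans (∑-units f) (∑-cong elems drop-guard)
    where
    drop-guard : ∀ x → whenNonzero x (f x) ≈ f x
    drop-guard x with x ≟ 0F
    ... | yes ≡.refl = sym f0≈0
    ... | no _       = refl

  ∑-elems-bijection : (σ ρ : F → F) → (∀ x → σ (ρ x) ≡ x) → (∀ x → ρ (σ x) ≡ x) →
                      (f : F → 𝕂) → Σ[ elems ] (λ x → f (σ x)) ≈ Σ[ elems ] f
  ∑-elems-bijection = ∑-bijection elems unique complete

  ∑-elems-*ˡ : ∀ a → a ≢ 0F → (f : F → 𝕂) → Σ[ elems ] (λ x → f (a *F x)) ≈ Σ[ elems ] f
  ∑-elems-*ˡ a a≢0 = ∑-elems-bijection (a *F_) (inv a *F_) (λ x → FP.inv-cancelˡ a x a≢0) (λ x → FP.inv-cancelʳ a x a≢0)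

  ∑-elems-+ˡ : ∀ a (f : F → 𝕂) → Σ[ elems ] (λ x → f (a +F x)) ≈ Σ[ elems ] f
  ∑-elems-+ˡ a = ∑-elems-bijection (a +F_) (_-F a)
    (λ x → FP.solve 2 (λ a x → a FP.:+ (x FP.:- a) FP.:= x) ≡.refl a x)
    (λ x → FP.solve 2 (λ a x → (a FP.:+ x) FP.:- a FP.:= x) ≡.refl a x)

  ∑-elems-inv : (f : F → 𝕂) → Σ[ elems ] (λ x → f (inv x)) ≈ Σ[ elems ] f
  ∑-elems-inv = ∑-elems-bijection inv inv FP.inv-involutive FP.inv-involutive

  χ-* : (ch : MulChar) → ∀ a b → χ ch (a *F b) ≈ χ ch a * χ ch b
  χ-* ch a b with a ≟ 0F | b ≟ 0F
  ... | yes ≡.refl | _ = begin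
    χ ch (0F *F b)        ≡⟨ ≡.cong (χ ch) (FP.zeroˡ b) ⟩
    χ ch 0F               ≈⟨ χ-0 ch ⟩
    0#                    ≈⟨ zeroˡ _ ⟨
    0# * χ ch b           ≈⟨ *-congʳ (χ-0 ch) ⟨
    χ ch 0F * χ ch b      ∎
  ... | no _ | yes ≡.refl = begin
    χ ch (a *F 0F)        ≡⟨ ≡.cong (χ ch) (FP.zeroʳ a) ⟩
    χ ch 0F               ≈⟨ χ-0 ch ⟩
    0#                    ≈⟨ zeroʳ _ ⟨
    χ ch a * 0#           ≈⟨ *-congˡ (χ-0 ch) ⟨
    χ ch a * χ ch 0F      ∎
  ... | no a≢0 | no b≢0 = χ-mul ch a b a≢0 b≢0

  conjχ-0 : (ch : MulChar) → conjχ ch 0F ≈ 0#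
  conjχ-0 ch = trans (reflexive (≡.cong (χ ch) inv-0)) (χ-0 ch)

  conjχ-[-1] : (ch : MulChar) → conjχ ch (-F 1F) ≈ χ ch (-F 1F)
  conjχ-[-1] ch = reflexive (≡.cong (χ ch) FP.inv-[-1])

  module WithInverses (invertible : ∀ (x : 𝕂) → ¬ (x ≈ 0#) → Σ 𝕂 λ y → x * y ≈ 1#) where

    ∑-χ : (ch : MulChar) → Nontrivial ch → Σ[ elems ] (χ ch) ≈ 0#
    ∑-χ ch (a , a≢0 , χa≉1) = fixed-by-≉1⇒≈0 invertible χa≉1 (begin
      Σ[ elems ] (χ ch)                          ≈⟨ ∑-elems-*ˡ a a≢0 (χ ch) ⟨
      Σ[ elems ] (λ x → χ ch (a *F x))           ≈⟨ ∑-cong elems (χ-* ch a) ⟩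
      Σ[ elems ] (λ x → χ ch a * χ ch x)         ≈⟨ ∑-*ˡ elems (χ ch a) (χ ch) ⟩
      χ ch a * Σ[ elems ] (χ ch)                 ∎)

    ∑-conjχ : (ch : MulChar) → Nontrivial ch → Σ[ elems ] (conjχ ch) ≈ 0#
    ∑-conjχ ch nontrivial = trans (∑-elems-inv (χ ch)) (∑-χ ch nontrivial)

    module WithRootOfUnity (ζ : 𝕂) (ζ^p≈1 : powK ζ p ≈ 1#) (ζ≉1 : ¬ (ζ ≈ 1#)) where

      private
        ζ^-+ : ∀ a b → powK ζ (a ℕ.+ b) ≈ powK ζ a * powK ζ b
        ζ^-+ zero    b = sym (*-identityˡ _)
        ζ^-+ (suc a) b = trans (*-congˡ (ζ^-+ a b)) (sym (*-assoc _ _ _))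

        module ζ^ = HomomorphismFromℕ *-monoid (powK ζ) refl ζ^-+

      ψ-+ : ∀ a b → ψ ζ (a +F b) ≈ ψ ζ a * ψ ζ b
      ψ-+ a b = begin
        powK ζ (trℕ (a +F b))                ≈⟨ ζ^.φ-% p ζ^p≈1 _ ⟩
        powK ζ (trℕ (a +F b) % p)            ≡⟨ ≡.cong (powK ζ) (trℕ-+ a b) ⟩
        powK ζ ((trℕ a ℕ.+ trℕ b) % p)       ≈⟨ ζ^.φ-% p ζ^p≈1 _ ⟨
        powK ζ (trℕ a ℕ.+ trℕ b)             ≈⟨ ζ^-+ (trℕ a) (trℕ b) ⟩
        powK ζ (trℕ a) * powK ζ (trℕ b)      ∎

      ψ-0 : ψ ζ 0F ≈ 1#
      ψ-0 = reflexive (≡.cong (powK ζ) trℕ-0)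

      ψ-nontrivial : Σ F λ x → ¬ (ψ ζ x ≈ 1#)
      ψ-nontrivial with trℕ-nontrivial
      ... | x , 0<trℕx , trℕx<p = x , λ ψx≈1 →
        ζ≉1 (trans (sym (*-identityʳ ζ)) (ζ^.φ-1≈ε p (trℕ x) p-prime ζ^p≈1 ψx≈1 0<trℕx trℕx<p))

      ∑-ψ : ∀ c → Σ[ elems ] (λ a → ψ ζ (c *F a)) ≈ [ c ≡F 0F ] * ℕ→K q
      ∑-ψ c with c ≟ 0F
      ... | yes ≡.refl = begin
        Σ[ elems ] (λ a → ψ ζ (0F *F a))   ≈⟨ ∑-cong elems (λ a → trans (reflexive (≡.cong (ψ ζ) (FP.zeroˡ a))) ψ-0) ⟩
        Σ[ elems ] (λ _ → 1#)              ≈⟨ ∑-const-1 elems ⟩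
        ℕ→K q                              ≈⟨ *-identityˡ _ ⟨
        1# * ℕ→K q                         ∎
      ... | no c≢0 = begin
        Σ[ elems ] (λ a → ψ ζ (c *F a))    ≈⟨ ∑-elems-*ˡ c c≢0 (ψ ζ) ⟩
        Σ[ elems ] (ψ ζ)                   ≈⟨ fixed-by-≉1⇒≈0 invertible (proj₂ ψ-nontrivial) translation-invariant ⟩
        0#                                 ≈⟨ zeroˡ _ ⟨
        0# * ℕ→K q                         ∎
        where
        x₀ = proj₁ ψ-nontrivial
        translation-invariant : Σ[ elems ] (ψ ζ) ≈ ψ ζ x₀ * Σ[ elems ] (ψ ζ)
        translation-invariant = begin
          Σ[ elems ] (ψ ζ)                       ≈⟨ ∑-elems-+ˡ x₀ (ψ ζ) ⟨
          Σ[ elems ] (λ a → ψ ζ (x₀ +F a))       ≈⟨ ∑-cong elems (ψ-+ x₀) ⟩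
          Σ[ elems ] (λ a → ψ ζ x₀ * ψ ζ a)      ≈⟨ ∑-*ˡ elems (ψ ζ x₀) (ψ ζ) ⟩
          ψ ζ x₀ * Σ[ elems ] (ψ ζ)              ∎

      -- τ(χ̄), not the complex conjugate of τ(χ).
      τ̄ : MulChar → 𝕂
      τ̄ ch = Σ[ elems ] λ u → conjχ ch u * ψ ζ u

      τ̄-twist : (ch : MulChar) → Nontrivial ch → ∀ c → Σ[ elems ] (λ u → conjχ ch u * ψ ζ (c *F u)) ≈ χ ch c * τ̄ ch
      τ̄-twist ch nontrivial c with c ≟ 0F
      ... | yes ≡.refl = begin
        Σ[ elems ] (λ u → conjχ ch u * ψ ζ (0F *F u))   ≈⟨ ∑-cong elems (λ u → trans (*-congˡ (trans (reflexive (≡.cong (ψ ζ) (FP.zeroˡ u))) ψ-0)) (*-identityʳ _)) ⟩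
        Σ[ elems ] (conjχ ch)                           ≈⟨ ∑-conjχ ch nontrivial ⟩
        0#                                              ≈⟨ zeroˡ _ ⟨
        0# * τ̄ ch                                       ≈⟨ *-congʳ (χ-0 ch) ⟨
        χ ch 0F * τ̄ ch                                  ∎
      ... | no c≢0 = begin
        Σ[ elems ] (λ u → conjχ ch u * ψ ζ (c *F u))                      ≈⟨ ∑-elems-*ˡ (inv c) (FP.inv-≢0 c c≢0) _ ⟨
        Σ[ elems ] (λ w → conjχ ch (inv c *F w) * ψ ζ (c *F (inv c *F w))) ≈⟨ ∑-cong elems term ⟩
        Σ[ elems ] (λ w → χ ch c * (conjχ ch w * ψ ζ w))                   ≈⟨ ∑-*ˡ elems (χ ch c) _ ⟩
        χ ch c * τ̄ ch                                                     ∎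
        where
        term : ∀ w → conjχ ch (inv c *F w) * ψ ζ (c *F (inv c *F w)) ≈ χ ch c * (conjχ ch w * ψ ζ w)
        term w = begin
          χ ch (inv (inv c *F w)) * ψ ζ (c *F (inv c *F w))   ≈⟨ *-cong (reflexive (≡.cong (χ ch) inv-c⁻¹w)) (reflexive (≡.cong (ψ ζ) (FP.inv-cancelˡ c w c≢0))) ⟩
          χ ch (c *F inv w) * ψ ζ w                           ≈⟨ *-congʳ (χ-* ch c (inv w)) ⟩
          (χ ch c * χ ch (inv w)) * ψ ζ w                     ≈⟨ *-assoc _ _ _ ⟩
          χ ch c * (conjχ ch w * ψ ζ w)                       ∎
          where
          inv-c⁻¹w : inv (inv c *F w) ≡ c *F inv w
          inv-c⁻¹w = ≡.trans (FP.inv-distrib-* (inv c) w) (≡.cong (_*F inv w) (FP.inv-involutive c))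

      -- Expand τ(χ) τ̄(χ) as a double sum; the inner sum over a is ∑-ψ.
      τ*τ̄ : (ch : MulChar) → Nontrivial ch → τ ζ ch * τ̄ ch ≈ χ ch (-F 1F) * ℕ→K q
      τ*τ̄ ch nontrivial = begin
        τ ζ ch * τ̄ ch                                                              ≈⟨ ∑-*ʳ elems (τ̄ ch) (λ a → χ ch a * ψ ζ a) ⟨
        Σ[ elems ] (λ a → (χ ch a * ψ ζ a) * τ̄ ch)                                ≈⟨ ∑-cong elems (λ a → solve 3 (λ x y t → (x :* y) :* t := y :* (x :* t)) refl (χ ch a) (ψ ζ a) (τ̄ ch)) ⟩
        Σ[ elems ] (λ a → ψ ζ a * (χ ch a * τ̄ ch))                                ≈⟨ ∑-cong elems (λ a → *-congˡ (τ̄-twist ch nontrivial a)) ⟨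
        Σ[ elems ] (λ a → ψ ζ a * Σ[ elems ] (λ b → conjχ ch b * ψ ζ (a *F b)))   ≈⟨ ∑-cong elems (λ a → trans (sym (∑-*ˡ elems (ψ ζ a) _)) (∑-cong elems (merge a))) ⟩
        Σ[ elems ] (λ a → Σ[ elems ] (λ b → conjχ ch b * ψ ζ ((1F +F b) *F a)))   ≈⟨ ∑-comm elems elems _ ⟩
        Σ[ elems ] (λ b → Σ[ elems ] (λ a → conjχ ch b * ψ ζ ((1F +F b) *F a)))   ≈⟨ ∑-cong elems (λ b → ∑-*ˡ elems (conjχ ch b) _) ⟩
        Σ[ elems ] (λ b → conjχ ch b * Σ[ elems ] (λ a → ψ ζ ((1F +F b) *F a)))   ≈⟨ ∑-cong elems (λ b → *-congˡ (∑-ψ (1F +F b))) ⟩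
        Σ[ elems ] (λ b → conjχ ch b * ([ 1F +F b ≡F 0F ] * ℕ→K q))               ≈⟨ ∑-cong elems (λ b → trans (*-congˡ (*-congʳ ([≡]-cong (1+b≡0⇒b≡-1 b) (b≡-1⇒1+b≡0 b)))) (solve 3 (λ x y z → x :* (y :* z) := y :* (x :* z)) refl _ _ _)) ⟩
        Σ[ elems ] (λ b → [ b ≡F -F 1F ] * (conjχ ch b * ℕ→K q))                  ≈⟨ ∑-[≡] (-F 1F) (λ b → conjχ ch b * ℕ→K q) ⟩
        conjχ ch (-F 1F) * ℕ→K q                                                   ≈⟨ *-congʳ (conjχ-[-1] ch) ⟩
        χ ch (-F 1F) * ℕ→K q                                                       ∎
        where
        merge : ∀ a b → ψ ζ a * (conjχ ch b * ψ ζ (a *F b)) ≈ conjχ ch b * ψ ζ ((1F +F b) *F a)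
        merge a b = begin
          ψ ζ a * (conjχ ch b * ψ ζ (a *F b))    ≈⟨ solve 3 (λ x y z → x :* (y :* z) := y :* (x :* z)) refl _ _ _ ⟩
          conjχ ch b * (ψ ζ a * ψ ζ (a *F b))    ≈⟨ *-congˡ (ψ-+ a (a *F b)) ⟨
          conjχ ch b * ψ ζ (a +F (a *F b))       ≡⟨ ≡.cong (λ t → conjχ ch b * ψ ζ t) (FP.solve 2 (λ a b → a FP.:+ (a FP.:* b) FP.:= (FP.:1 FP.:+ b) FP.:* a) ≡.refl a b) ⟩
          conjχ ch b * ψ ζ ((1F +F b) *F a)      ∎
        1+b≡0⇒b≡-1 : ∀ b → 1F +F b ≡ 0F → b ≡ -F 1F
        1+b≡0⇒b≡-1 b 1+b≡0 = ≡.trans (FP.solve 1 (λ b → b FP.:= (FP.:1 FP.:+ b) FP.:- FP.:1) ≡.refl b)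
                                 (≡.trans (≡.cong (_-F 1F) 1+b≡0) (FP.+-identityˡ _))
        b≡-1⇒1+b≡0 : ∀ b → b ≡ -F 1F → 1F +F b ≡ 0F
        b≡-1⇒1+b≡0 b b≡-1 = ≡.trans (≡.cong (1F +F_) b≡-1) (FP.-‿inverseʳ 1F)

module KatzSumComputation {c ℓ : Level} (𝔽 : FiniteField) (K : CommutativeRing c ℓ) where
  open CommutativeRing K renaming (Carrier to 𝕂)
  open CharSums 𝔽 K

  module _ (invertible : ∀ (x : 𝕂) → ¬ (x ≈ 0#) → Σ 𝕂 λ y → x * y ≈ 1#)
           (ζ : 𝕂) (ζ^p≈1 : powK ζ (FiniteField.p 𝔽) ≈ 1#) (ζ≉1 : ¬ (ζ ≈ 1#))
           (ch eh : MulChar) (χ-nontrivial : Nontrivial ch) (η-nontrivial : Nontrivial eh)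
           (y : FiniteField.F 𝔽) (y≢0 : y ≢ FiniteField.0# 𝔽) where

    open FiniteField 𝔽 renaming (_+_ to _+F_; _*_ to _*F_; -_ to -F_; 0# to 0F; 1# to 1F; _-_ to _-F_)
    open ListSums K
    open IntegerCoefficientSolver K
    open CharacterSumProperties 𝔽 K
    open WithInverses invertible
    open WithRootOfUnity ζ ζ^p≈1 ζ≉1
    open import Relation.Binary.Reasoning.Setoid setoid

    χ̄ η̄ : F → 𝕂
    χ̄ = conjχ ch
    η̄ = conjχ eh

    ψ′ : F → 𝕂
    ψ′ = ψ ζ

    summand : F → F → F → F → 𝕂
    summand x₁ x₂ y₁ y₂ = [ x₁ *F x₂ ≡F y *F (y₁ *F y₂) ] * (χ̄ y₁ * (η̄ y₂ * ψ′ (((x₁ +F x₂) -F y₁) -F y₂)))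

    -- The summand vanishes when x₂, y₁ or y₂ is 0, so these may range over all of F.
    Hsum≈∑units∑elems : Hsum ζ ch eh y ≈
      Σ[ units ] λ x₁ → Σ[ elems ] λ x₂ → Σ[ elems ] λ y₁ → Σ[ elems ] λ y₂ → summand x₁ x₂ y₁ y₂
    Hsum≈∑units∑elems = ∑-cong units λ x₁ →
      trans (∑-cong units λ x₂ →
        trans (∑-cong units λ y₁ → ∑-units≈∑-elems _ (vanishes-y₂ x₁ x₂ y₁))
              (∑-units≈∑-elems _ (∑-zero elems λ y₂ → vanishes-y₁ x₁ x₂ y₂)))
            (∑-units≈∑-elems _ (∑-zero elems λ y₁ → ∑-zero elems λ y₂ → vanishes-x₂ x₁ y₁ y₂))
      where
      vanishes-y₂ : ∀ x₁ x₂ y₁ → summand x₁ x₂ y₁ 0F ≈ 0#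
      vanishes-y₂ x₁ x₂ y₁ = trans (*-congˡ (*-congˡ (trans (*-congʳ (conjχ-0 eh)) (zeroˡ _)))) (trans (*-congˡ (zeroʳ _)) (zeroʳ _))
      vanishes-y₁ : ∀ x₁ x₂ y₂ → summand x₁ x₂ 0F y₂ ≈ 0#
      vanishes-y₁ x₁ x₂ y₂ = trans (*-congˡ (trans (*-congʳ (conjχ-0 ch)) (zeroˡ _))) (zeroʳ _)
      vanishes-x₂ : ∀ x₁ y₁ y₂ → summand x₁ 0F y₁ y₂ ≈ 0#
      vanishes-x₂ x₁ y₁ y₂ with y₁ ≟ 0F | y₂ ≟ 0F
      ... | yes ≡.refl | _          = vanishes-y₁ x₁ 0F y₂
      ... | no _       | yes ≡.refl = vanishes-y₂ x₁ 0F y₁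
      ... | no y₁≢0    | no y₂≢0    = trans (*-congʳ ([≡]-no x₁0≢yy₁y₂)) (zeroˡ _)
        where
        x₁0≢yy₁y₂ : x₁ *F 0F ≢ y *F (y₁ *F y₂)
        x₁0≢yy₁y₂ e = FP.*-≢0 y≢0 (FP.*-≢0 y₁≢0 y₂≢0) (≡.trans (≡.sym e) (FP.zeroʳ x₁))

    d : F → F → F
    d x₁ y₁ = ((inv x₁ *F y) *F y₁) -F 1F

    -- Solve x₁ x₂ = y y₁ y₂ for x₂; the y₂-sum is then a twisted Gauss sum of η.
    ∑x₂y₁y₂-summand : ∀ x₁ → x₁ ≢ 0F →
      (Σ[ elems ] λ x₂ → Σ[ elems ] λ y₁ → Σ[ elems ] λ y₂ → summand x₁ x₂ y₁ y₂) ≈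
      (Σ[ elems ] λ y₁ → (ψ′ (x₁ -F y₁) * χ̄ y₁) * (χ eh (d x₁ y₁) * τ̄ eh))
    ∑x₂y₁y₂-summand x₁ x₁≢0 = begin
      (Σ[ elems ] λ x₂ → Σ[ elems ] λ y₁ → Σ[ elems ] λ y₂ → summand x₁ x₂ y₁ y₂)   ≈⟨ ∑-comm elems elems _ ⟩
      (Σ[ elems ] λ y₁ → Σ[ elems ] λ x₂ → Σ[ elems ] λ y₂ → summand x₁ x₂ y₁ y₂)   ≈⟨ ∑-cong elems (λ y₁ → ∑-comm elems elems _) ⟩
      (Σ[ elems ] λ y₁ → Σ[ elems ] λ y₂ → Σ[ elems ] λ x₂ → summand x₁ x₂ y₁ y₂)   ≈⟨ ∑-cong elems (λ y₁ → ∑-cong elems (∑x₂ y₁)) ⟩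
      (Σ[ elems ] λ y₁ → Σ[ elems ] λ y₂ → (ψ′ (x₁ -F y₁) * χ̄ y₁) * (η̄ y₂ * ψ′ (d x₁ y₁ *F y₂)))  ≈⟨ ∑-cong elems (λ y₁ → ∑-*ˡ elems _ _) ⟩
      (Σ[ elems ] λ y₁ → (ψ′ (x₁ -F y₁) * χ̄ y₁) * Σ[ elems ] λ y₂ → η̄ y₂ * ψ′ (d x₁ y₁ *F y₂))    ≈⟨ ∑-cong elems (λ y₁ → *-congˡ (τ̄-twist eh η-nontrivial (d x₁ y₁))) ⟩
      (Σ[ elems ] λ y₁ → (ψ′ (x₁ -F y₁) * χ̄ y₁) * (χ eh (d x₁ y₁) * τ̄ eh))          ∎
      where
      ∑x₂ : ∀ y₁ y₂ → Σ[ elems ] (λ x₂ → summand x₁ x₂ y₁ y₂) ≈ (ψ′ (x₁ -F y₁) * χ̄ y₁) * (η̄ y₂ * ψ′ (d x₁ y₁ *F y₂))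
      ∑x₂ y₁ y₂ = begin
        Σ[ elems ] (λ x₂ → summand x₁ x₂ y₁ y₂)                                            ≈⟨ ∑-cong elems (λ x₂ → *-congʳ ([≡]-cong (solved x₂) (unsolved x₂))) ⟩
        Σ[ elems ] (λ x₂ → [ x₂ ≡F inv x₁ *F m ] * (χ̄ y₁ * (η̄ y₂ * ψ′ (((x₁ +F x₂) -F y₁) -F y₂)))) ≈⟨ ∑-[≡] (inv x₁ *F m) _ ⟩
        χ̄ y₁ * (η̄ y₂ * ψ′ (((x₁ +F (inv x₁ *F m)) -F y₁) -F y₂))                          ≡⟨ ≡.cong (λ t → χ̄ y₁ * (η̄ y₂ * ψ′ t)) rearrange ⟩
        χ̄ y₁ * (η̄ y₂ * ψ′ ((x₁ -F y₁) +F (d x₁ y₁ *F y₂)))                                ≈⟨ *-congˡ (*-congˡ (ψ-+ _ _)) ⟩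
        χ̄ y₁ * (η̄ y₂ * (ψ′ (x₁ -F y₁) * ψ′ (d x₁ y₁ *F y₂)))                              ≈⟨ solve 4 (λ a b c e → a :* (b :* (c :* e)) := (c :* a) :* (b :* e)) refl _ _ _ _ ⟩
        (ψ′ (x₁ -F y₁) * χ̄ y₁) * (η̄ y₂ * ψ′ (d x₁ y₁ *F y₂))                              ∎
        where
        m = y *F (y₁ *F y₂)
        solved : ∀ x₂ → x₁ *F x₂ ≡ m → x₂ ≡ inv x₁ *F m
        solved x₂ e = ≡.trans (≡.sym (FP.inv-cancelʳ x₁ x₂ x₁≢0)) (≡.cong (inv x₁ *F_) e)
        unsolved : ∀ x₂ → x₂ ≡ inv x₁ *F m → x₁ *F x₂ ≡ m
        unsolved x₂ e = ≡.trans (≡.cong (x₁ *F_) e) (FP.inv-cancelˡ x₁ m x₁≢0)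
        rearrange : ((x₁ +F (inv x₁ *F m)) -F y₁) -F y₂ ≡ (x₁ -F y₁) +F (d x₁ y₁ *F y₂)
        rearrange = FP.solve 5 (λ x i y y₁ y₂ → ((x FP.:+ (i FP.:* (y FP.:* (y₁ FP.:* y₂)))) FP.:- y₁) FP.:- y₂
                                  FP.:= (x FP.:- y₁) FP.:+ ((((i FP.:* y) FP.:* y₁) FP.:- FP.:1) FP.:* y₂))
                      ≡.refl x₁ (inv x₁) y y₁ y₂

    J₁ : 𝕂
    J₁ = Σ[ units ] λ x₁ → Σ[ elems ] λ y₁ → (ψ′ (x₁ -F y₁) * χ̄ y₁) * χ eh (1F -F ((inv x₁ *F y) *F y₁))

    τη*Hsum≈q*J₁ : τ ζ eh * Hsum ζ ch eh y ≈ ℕ→K q * J₁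
    τη*Hsum≈q*J₁ = begin
      τ ζ eh * Hsum ζ ch eh y
        ≈⟨ *-congˡ (trans Hsum≈∑units∑elems (∑-cong∈ units (λ x₁ x₁∈ → ∑x₂y₁y₂-summand x₁ (∈-units⇒≢0 x₁∈)))) ⟩
      τ ζ eh * (Σ[ units ] λ x₁ → Σ[ elems ] λ y₁ → A x₁ y₁ * (χ eh (d x₁ y₁) * τ̄ eh))
        ≈⟨ ∑∑-*ˡ _ ⟨
      (Σ[ units ] λ x₁ → Σ[ elems ] λ y₁ → τ ζ eh * (A x₁ y₁ * (χ eh (d x₁ y₁) * τ̄ eh)))
        ≈⟨ ∑-cong units (λ x₁ → ∑-cong elems (term x₁)) ⟩
      (Σ[ units ] λ x₁ → Σ[ elems ] λ y₁ → ℕ→K q * (A x₁ y₁ * χ eh (1F -F ((inv x₁ *F y) *F y₁))))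
        ≈⟨ ∑∑-*ˡ _ ⟩
      ℕ→K q * J₁
        ∎
      where
      A : F → F → 𝕂
      A x₁ y₁ = ψ′ (x₁ -F y₁) * χ̄ y₁
      ∑∑-*ˡ : ∀ {k} (f : F → F → 𝕂) → (Σ[ units ] λ a → Σ[ elems ] λ b → k * f a b) ≈ k * (Σ[ units ] λ a → Σ[ elems ] λ b → f a b)
      ∑∑-*ˡ {k} f = trans (∑-cong units (λ a → ∑-*ˡ elems k (f a))) (∑-*ˡ units k _)
      term : ∀ x₁ y₁ → τ ζ eh * (A x₁ y₁ * (χ eh (d x₁ y₁) * τ̄ eh)) ≈ ℕ→K q * (A x₁ y₁ * χ eh (1F -F ((inv x₁ *F y) *F y₁)))
      term x₁ y₁ = begin
        τ ζ eh * (A x₁ y₁ * (χ eh (d x₁ y₁) * τ̄ eh))                   ≈⟨ solve 4 (λ t a e u → t :* (a :* (e :* u)) := (t :* u) :* (a :* e)) refl _ _ _ _ ⟩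
        (τ ζ eh * τ̄ eh) * (A x₁ y₁ * χ eh (d x₁ y₁))                   ≈⟨ *-congʳ (τ*τ̄ eh η-nontrivial) ⟩
        (χ eh (-F 1F) * ℕ→K q) * (A x₁ y₁ * χ eh (d x₁ y₁))            ≈⟨ solve 4 (λ m Q a e → (m :* Q) :* (a :* e) := Q :* (a :* (m :* e))) refl _ _ _ _ ⟩
        ℕ→K q * (A x₁ y₁ * (χ eh (-F 1F) * χ eh (d x₁ y₁)))            ≈⟨ *-congˡ (*-congˡ (χ-* eh _ _)) ⟨
        ℕ→K q * (A x₁ y₁ * χ eh ((-F 1F) *F d x₁ y₁))                  ≡⟨ ≡.cong (λ t → ℕ→K q * (A x₁ y₁ * χ eh t)) (FP.-1*[x-1]≡1-x _) ⟩
        ℕ→K q * (A x₁ y₁ * χ eh (1F -F ((inv x₁ *F y) *F y₁)))         ∎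

    J₂ : 𝕂
    J₂ = Σ[ elems ] λ y₁ → χ̄ y₁ * Σ[ units ] λ w → ψ′ ((w -F 1F) *F y₁) * χ eh (1F -F (y *F inv w))

    -- Substitute x₁ = y₁ w in the inner sum.
    J₁≈J₂ : J₁ ≈ J₂
    J₁≈J₂ = begin
      J₁                                                                         ≈⟨ ∑-comm units elems _ ⟩
      (Σ[ elems ] λ y₁ → Σ[ units ] λ x₁ → (ψ′ (x₁ -F y₁) * χ̄ y₁) * g y₁ x₁)   ≈⟨ ∑-cong elems (λ y₁ → ∑-cong units (λ x₁ → solve 3 (λ a b c → (a :* b) :* c := b :* (a :* c)) refl _ _ _)) ⟩
      (Σ[ elems ] λ y₁ → Σ[ units ] λ x₁ → χ̄ y₁ * (ψ′ (x₁ -F y₁) * g y₁ x₁))   ≈⟨ ∑-cong elems (λ y₁ → ∑-*ˡ units (χ̄ y₁) _) ⟩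
      (Σ[ elems ] λ y₁ → χ̄ y₁ * Σ[ units ] λ x₁ → ψ′ (x₁ -F y₁) * g y₁ x₁)     ≈⟨ ∑-cong elems substitute ⟩
      J₂                                                                         ∎
      where
      g : F → F → 𝕂
      g y₁ x₁ = χ eh (1F -F ((inv x₁ *F y) *F y₁))
      h : F → F → 𝕂
      h y₁ w = ψ′ ((w -F 1F) *F y₁) * χ eh (1F -F (y *F inv w))
      substitute : ∀ y₁ → χ̄ y₁ * (Σ[ units ] λ x₁ → ψ′ (x₁ -F y₁) * g y₁ x₁) ≈ χ̄ y₁ * Σ[ units ] (h y₁)
      substitute y₁ with y₁ ≟ 0F
      ... | yes ≡.refl = trans (*-congʳ (conjχ-0 ch)) (trans (zeroˡ _) (sym (trans (*-congʳ (conjχ-0 ch)) (zeroˡ _))))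
      ... | no y₁≢0 = *-congˡ (begin
        (Σ[ units ] λ x₁ → ψ′ (x₁ -F y₁) * g y₁ x₁)                           ≈⟨ ∑-units _ ⟩
        (Σ[ elems ] λ x → whenNonzero x (ψ′ (x -F y₁) * g y₁ x))              ≈⟨ ∑-elems-*ˡ y₁ y₁≢0 _ ⟨
        (Σ[ elems ] λ w → whenNonzero (y₁ *F w) (ψ′ ((y₁ *F w) -F y₁) * g y₁ (y₁ *F w)))  ≈⟨ ∑-cong elems term ⟩
        (Σ[ elems ] λ w → whenNonzero w (h y₁ w))                             ≈⟨ ∑-units (h y₁) ⟨
        Σ[ units ] (h y₁)                                                     ∎)
        where
        term : ∀ w → whenNonzero (y₁ *F w) (ψ′ ((y₁ *F w) -F y₁) * g y₁ (y₁ *F w)) ≈ whenNonzero w (h y₁ w)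
        term w with w ≟ 0F
        ... | yes ≡.refl = trans (reflexive (≡.cong (λ t → whenNonzero t (ψ′ ((y₁ *F 0F) -F y₁) * g y₁ (y₁ *F 0F))) (FP.zeroʳ y₁)))
                                 (whenNonzero-0 _)
        ... | no w≢0 = begin
          whenNonzero (y₁ *F w) (ψ′ ((y₁ *F w) -F y₁) * g y₁ (y₁ *F w))  ≈⟨ whenNonzero-≢0 _ (FP.*-≢0 y₁≢0 w≢0) ⟩
          ψ′ ((y₁ *F w) -F y₁) * χ eh (1F -F ((inv (y₁ *F w) *F y) *F y₁)) ≡⟨ ≡.cong₂ (λ a b → ψ′ a * χ eh (1F -F b)) y₁w-y₁ y₁⁻¹w⁻¹yy₁ ⟩
          h y₁ w                                                          ∎
          where
          y₁w-y₁ : (y₁ *F w) -F y₁ ≡ (w -F 1F) *F y₁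
          y₁w-y₁ = FP.solve 2 (λ a w → (a FP.:* w) FP.:- a FP.:= (w FP.:- FP.:1) FP.:* a) ≡.refl y₁ w
          y₁⁻¹w⁻¹yy₁ : (inv (y₁ *F w) *F y) *F y₁ ≡ y *F inv w
          y₁⁻¹w⁻¹yy₁ = ≡.trans (≡.cong (λ t → (t *F y) *F y₁) (FP.inv-distrib-* y₁ w))
            (≡.trans (FP.solve 4 (λ a i j y → ((i FP.:* j) FP.:* y) FP.:* a FP.:= (a FP.:* i) FP.:* (y FP.:* j)) ≡.refl y₁ (inv y₁) (inv w) y)
            (≡.trans (≡.cong (_*F (y *F inv w)) (inv-r y₁ y₁≢0)) (FP.*-identityˡ _)))

    J₃ : 𝕂
    J₃ = Σ[ units ] λ w → χ eh (1F -F (y *F inv w)) * χ ch (w -F 1F)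

    J₂≈J₃*τ̄χ : J₂ ≈ J₃ * τ̄ ch
    J₂≈J₃*τ̄χ = begin
      J₂                                                                                          ≈⟨ ∑-cong elems (λ y₁ → ∑-*ˡ units (χ̄ y₁) _) ⟨
      (Σ[ elems ] λ y₁ → Σ[ units ] λ w → χ̄ y₁ * (ψ′ ((w -F 1F) *F y₁) * η₁ w))               ≈⟨ ∑-comm elems units _ ⟩
      (Σ[ units ] λ w → Σ[ elems ] λ y₁ → χ̄ y₁ * (ψ′ ((w -F 1F) *F y₁) * η₁ w))               ≈⟨ ∑-cong units (λ w → ∑-cong elems (λ y₁ → solve 3 (λ a b c → a :* (b :* c) := c :* (a :* b)) refl _ _ _)) ⟩
      (Σ[ units ] λ w → Σ[ elems ] λ y₁ → η₁ w * (χ̄ y₁ * ψ′ ((w -F 1F) *F y₁)))               ≈⟨ ∑-cong units (λ w → ∑-*ˡ elems _ _) ⟩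
      (Σ[ units ] λ w → η₁ w * Σ[ elems ] λ y₁ → χ̄ y₁ * ψ′ ((w -F 1F) *F y₁))                 ≈⟨ ∑-cong units (λ w → *-congˡ (τ̄-twist ch χ-nontrivial (w -F 1F))) ⟩
      (Σ[ units ] λ w → η₁ w * (χ ch (w -F 1F) * τ̄ ch))                                       ≈⟨ ∑-cong units (λ w → sym (*-assoc _ _ _)) ⟩
      (Σ[ units ] λ w → (η₁ w * χ ch (w -F 1F)) * τ̄ ch)                                       ≈⟨ ∑-*ʳ units _ _ ⟩
      J₃ * τ̄ ch                                                                               ∎
      where
      η₁ : F → 𝕂
      η₁ w = χ eh (1F -F (y *F inv w))

    J₄ : 𝕂
    J₄ = Σ[ units ] λ w → χ eh (1F -F (y *F inv w)) * χ ch (1F -F w)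

    χ[-1]*J₃≈J₄ : χ ch (-F 1F) * J₃ ≈ J₄
    χ[-1]*J₃≈J₄ = trans (sym (∑-*ˡ units _ _)) (∑-cong units λ w → begin
      χ ch (-F 1F) * (χ eh (1F -F (y *F inv w)) * χ ch (w -F 1F))   ≈⟨ solve 3 (λ a b c → a :* (b :* c) := b :* (a :* c)) refl _ _ _ ⟩
      χ eh (1F -F (y *F inv w)) * (χ ch (-F 1F) * χ ch (w -F 1F))   ≈⟨ *-congˡ (χ-* ch _ _) ⟨
      χ eh (1F -F (y *F inv w)) * χ ch ((-F 1F) *F (w -F 1F))       ≡⟨ ≡.cong (λ t → χ eh (1F -F (y *F inv w)) * χ ch t) (FP.-1*[x-1]≡1-x w) ⟩
      χ eh (1F -F (y *F inv w)) * χ ch (1F -F w)                    ∎)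

    -- Substitute w = 1 - t.
    J₄≈B : J₄ ≈ B ch eh y
    J₄≈B = begin
      J₄                                                          ≈⟨ ∑-units k ⟩
      (Σ[ elems ] λ w → whenNonzero w (k w))                      ≈⟨ ∑-elems-bijection (λ t → 1F -F t) (λ t → 1F -F t) FP.1-[1-x]≡x FP.1-[1-x]≡x _ ⟨
      (Σ[ elems ] λ t → whenNonzero (1F -F t) (k (1F -F t)))      ≈⟨ ∑-cong elems term ⟩
      (Σ[ elems ] λ t → whenNonzero t (if does (≢1? t) then f t else 0#))  ≈⟨ ∑-units _ ⟨
      (Σ[ units ] λ t → if does (≢1? t) then f t else 0#)         ≈⟨ ∑-filter ≢1? units f ⟨
      B ch eh y                                                   ∎
      where
      k f : F → 𝕂
      k w = χ eh (1F -F (y *F inv w)) * χ ch (1F -F w)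
      f t = χ ch t * χ eh (1F -F (y *F inv (1F -F t)))
      ≢1? : (t : F) → Dec (t ≢ 1F)
      ≢1? t = ¬? (t ≟ 1F)
      term : ∀ t → whenNonzero (1F -F t) (k (1F -F t)) ≈ whenNonzero t (if does (≢1? t) then f t else 0#)
      term t with t ≟ 0F | t ≟ 1F
      ... | yes ≡.refl | _ = trans (whenNonzero-≢0 _ FP.1-0≢0) (trans (*-congˡ (trans (reflexive (≡.cong (χ ch) (FP.1-[1-x]≡x 0F))) (χ-0 ch))) (zeroʳ _))
      ... | no _ | yes ≡.refl = trans (reflexive (≡.cong (λ u → whenNonzero u (k (1F -F 1F))) (FP.-‿inverseʳ 1F))) (whenNonzero-0 _)
      ... | no _ | no t≢1 = begin
        whenNonzero (1F -F t) (k (1F -F t))                                  ≈⟨ whenNonzero-≢0 _ (λ 1-t≡0 → t≢1 (≡.sym (FP.x-y≡0⇒x≡y 1F t 1-t≡0))) ⟩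
        χ eh (1F -F (y *F inv (1F -F t))) * χ ch (1F -F (1F -F t))          ≈⟨ *-comm _ _ ⟩
        χ ch (1F -F (1F -F t)) * χ eh (1F -F (y *F inv (1F -F t)))          ≡⟨ ≡.cong (λ u → χ ch u * χ eh (1F -F (y *F inv (1F -F t)))) (FP.1-[1-x]≡x t) ⟩
        f t                                                                 ∎

    τχ*τη*Hsum≈q*q*B : τ ζ ch * (τ ζ eh * Hsum ζ ch eh y) ≈ ℕ→K q * (ℕ→K q * B ch eh y)
    τχ*τη*Hsum≈q*q*B = begin
      τ ζ ch * (τ ζ eh * Hsum ζ ch eh y)         ≈⟨ *-congˡ (trans τη*Hsum≈q*J₁ (*-congˡ (trans J₁≈J₂ J₂≈J₃*τ̄χ))) ⟩
      τ ζ ch * (ℕ→K q * (J₃ * τ̄ ch))             ≈⟨ solve 4 (λ t Q a u → t :* (Q :* (a :* u)) := Q :* ((t :* u) :* a)) refl _ _ _ _ ⟩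
      ℕ→K q * ((τ ζ ch * τ̄ ch) * J₃)             ≈⟨ *-congˡ (*-congʳ (τ*τ̄ ch χ-nontrivial)) ⟩
      ℕ→K q * ((χ ch (-F 1F) * ℕ→K q) * J₃)      ≈⟨ *-congˡ (solve 3 (λ m Q a → (m :* Q) :* a := Q :* (m :* a)) refl _ _ _) ⟩
      ℕ→K q * (ℕ→K q * (χ ch (-F 1F) * J₃))      ≈⟨ *-congˡ (*-congˡ (trans χ[-1]*J₃≈J₄ J₄≈B)) ⟩
      ℕ→K q * (ℕ→K q * B ch eh y)                ∎

lemma5p9 : {c ℓ : Level} (𝔽 : FiniteField) (K : CommutativeRing c ℓ) →
    let open CommutativeRing K
        open CharSums 𝔽 K
    in
    -- K is a field of characteristic 0 (in the paper: K = ℂ)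
    (∀ (x : Carrier) → ¬ (x ≈ 0#) → Σ Carrier λ y → x * y ≈ 1#) →
    ¬ (0# ≈ 1#) →
    (∀ (m : ℕ) → ℕ→K m ≈ 0# → m ≡ 0) →
    -- ζ is a primitive p-th root of unity (in the paper ζ = e^{2πi/p})
    (ζ : Carrier) → powK ζ (FiniteField.p 𝔽) ≈ 1# → ¬ (ζ ≈ 1#) →
    -- s = √q and sinv = 1/√q
    (s sinv : Carrier) → s * s ≈ ℕ→K (FiniteField.q 𝔽) → s * sinv ≈ 1# →
    -- χ, η non-trivial characters of F_q^×
    (ch eh : MulChar) → Nontrivial ch → Nontrivial eh →
    (y : FiniteField.F 𝔽) → y ≢ FiniteField.0# 𝔽 →
    B ch eh y ≈ ((- (τ ζ ch * τ ζ eh)) * sinv) * H ζ sinv ch eh y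
-- 0 ≉ 1 and characteristic 0 go unused: the only division needed is by s, whose inverse sinv is given.
lemma5p9 𝔽 K invertible _ _ ζ ζ^p≈1 ζ≉1 s sinv s*s≈q s*sinv≈1 ch eh χ-nontrivial η-nontrivial y y≢0 =
  divide-by-square (τχ*τη*Hsum≈q*q*B invertible ζ ζ^p≈1 ζ≉1 ch eh χ-nontrivial η-nontrivial y y≢0) s*s≈q s*sinv≈1
  where
  open CommutativeRingLemmas K using (divide-by-square)
  open KatzSumComputation 𝔽 K using (τχ*τη*Hsum≈q*q*B)
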